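{- Let $q$ be a prime power, $c\ge 1$, $t\ge -1$, and $L:\mathbb{F}_q^m\to\mathbb{F}_q^r$ a linear map given by a full-rank matrix $A\in\mathbb{Z}^{r\times m}$ with entries coprime to $q$, with $\mathcal{S}_L(\mathbb{F}_q^n)\neq\emptyset$, which is admissible (i.e. $t\ge 0$, or $t=-1$ and $L$ is invariant). Then for all integers $\dim_t(L)\le k\le n$, every coloring $\gamma\in\Gamma^t(n)$ and every color $1\le i\le c$, $$s^t_L(\gamma^{(i)})=\sum_{\delta\in\Gamma^t(k)}s^t_L(\delta^{(i)})\,p_t(\delta;\gamma).$$
   Context: $\mathcal{S}'_L(T)=\{{\bf s}\in T^m: A\cdot{\bf s}={\bf 0}\}$ for $T\subseteq\mathbb{F}_q^n$. Let $e_0=0$ and $e_j$ the unit vectors of $\mathbb{F}_q^n$; an affine map $\varphi:\mathbb{F}_q^k\to\mathbb{F}_q^n$ is $t$-fixed ($t\ge0$) if $\varphi(e_j)=e_j$ for $0\le j\le t$, every affine map being $(-1)$-fixed; $t^+=\max\{t,0\}$; a $t$-fixed $k$-dimensional subspace is the image of an injective $t$-fixed affine map. $\dim_t({\bf s})$ is the smallest $k\ge t^+$ such that a $t$-fixed $k$-dimensional subspace contains all entries of ${\bf s}$, and $\dim_t(L)$ the maximum over all solutions in all dimensions. $L$ is invariant if translates of solutions are solutions. $\mathcal{S}^t_L(T)=\{{\bf s}\in\mathcal{S}'_L(T):\dim_t({\bf s})=\dim_t(L)\}$ and $s^t_L(T)=|\mathcal{S}^t_L(T)|/|\mathcal{S}^t_L(\mathbb{F}_q^{n})|$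 where $n$ is the dimension of the ambient space of $T$. A $c$-coloring of dimension $n$ is $\gamma:\mathbb{F}_q^n\to\{1,\dots,c\}$, $\gamma^{(i)}=\gamma^{ -1}(i)$; $\gamma_1\cong_t\gamma_2$ if $\gamma_1=\gamma_2\circ\varphi$ for a $t$-fixed affine bijection $\varphi$; $\Gamma^t(n)$ is the set of $c$-colorings of $\mathbb{F}_q^n$ up to $\cong_t$. $\operatorname{Mon}_t(k;n)$ is the set of injective $t$-fixed affine maps $\mathbb{F}_q^k\to\mathbb{F}_q^n$ up to precomposition with $t$-fixed affine bijections of $\mathbb{F}_q^k$, and $p_t(\delta;\gamma)$ is the probability that a uniform $\varphi\in\operatorname{Mon}_t(k;n)$ satisfies $\gamma\circ\varphi\cong_t\delta$. -}

module Defs where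

open import Data.Nat as ℕ using (ℕ; zero; suc; _≤_; _∸_)
open import Data.Nat.Primality using (Prime)
open import Data.Nat.Coprimality using (Coprime)
open import Data.Integer as ℤ using (ℤ; +_; -[1+_]; ∣_∣)
open import Data.Rational as ℚ using (ℚ; 0ℚ)
open import Data.Fin as Fin using (Fin; toℕ)
open import Data.Vec as Vec using (Vec; []; _∷_; toList; replicate; zipWith; tabulate)
import Data.Vec.Properties as VecP
open import Data.List as List using (List; []; _∷_; length; filter; concatMap; upTo; cartesianProduct)
open import Data.List.Membership.Propositional using (_∈_)
open import Data.List.Relation.Unary.Unique.Propositional using (Unique)
open import Data.List.Relation.Unary.All using (All; all?)
open import Data.List.Relation.Unary.Any using (Any; any?)
open import Data.List.Relation.Unary.AllPairs using (AllPairs)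
open import Data.Product using (Σ; ∃; _×_; _,_; proj₁; proj₂)
open import Data.Sum using (_⊎_)
open import Data.Unit using (⊤)
open import Data.Bool using (if_then_else_)
open import Relation.Nullary using (¬_; Dec; yes; _×-dec_; _→-dec_; ¬?)
open import Relation.Unary using (Decidable)
open import Relation.Binary.PropositionalEquality using (_≡_; _≢_)
open import Algebra.Structures using (IsCommutativeRing)

record FiniteField : Set₁ where
  field
    Carrier : Set
    _+_ _*_ : Carrier → Carrier → Carrier
    -_      : Carrier → Carrier
    0# 1#   : Carrier
    isCommutativeRing : IsCommutativeRing _≡_ _+_ _*_ -_ 0# 1#
    0≢1     : 0# ≢ 1#
    inverse : ∀ x → x ≢ 0# → ∃ λ y → x * y ≡ 1#
    _≟_     : (x y : Carrier) → Dec (x ≡ y)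
    elems   : List Carrier
    complete : ∀ x → x ∈ elems
    unique  : Unique elems

  order : ℕ
  order = length elems

IsPrimePower : ℕ → Set
IsPrimePower q = Σ ℕ λ p → Σ ℕ λ e → Prime p × q ≡ p ℕ.^ suc e

vecsOf : {A : Set} → List A → (n : ℕ) → List (Vec A n)
vecsOf xs zero    = [] ∷ []
vecsOf xs (suc n) = concatMap (λ x → List.map (x ∷_) (vecsOf xs n)) xs

-- t ≥ -1 is encoded through  u = t + 1  (the number of fixed points e_0,…,e_t)
tplus1 : ℤ → ℕ
tplus1 t = ∣ t ℤ.+ ℤ.1ℤ ∣

-- t⁺ = max{t,0}
tplusPos : ℤ → ℕ
tplusPos t = tplus1 t ∸ 1

-- rational a/b, with the convention a/0 = 0 (never used: denominators are non-zero)
frac : ℕ → ℕ → ℚ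
frac a zero    = 0ℚ
frac a (suc b) = (+ a) ℚ./ suc b

sumℚ : List ℚ → ℚ
sumℚ = List.foldr ℚ._+_ 0ℚ

module _ (F : FiniteField) where
  open FiniteField F

  Pt : ℕ → Set
  Pt n = Vec Carrier n

  pts : (n : ℕ) → List (Pt n)
  pts n = vecsOf elems n

  _≟v_ : ∀ {n} → (x y : Pt n) → Dec (x ≡ y)
  _≟v_ = VecP.≡-dec _≟_

  vzero : ∀ {n} → Pt n
  vzero = replicate _ 0#

  vadd : ∀ {n} → Pt n → Pt n → Pt n
  vadd = zipWith _+_

  scale : ∀ {n} → Carrier → Pt n → Pt n
  scale a = Vec.map (a *_)

  dot : ∀ {k} → Pt k → Pt k → Carrier
  dot x y = Vec.foldr _ _+_ 0# (zipWith _*_ x y)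

  -- e_0 = 0 and e_j (1 ≤ j ≤ n) the j-th unit vector of F_q^n
  unit : ∀ {n} → ℕ → Pt n
  unit j = tabulate λ i → if suc (toℕ i) ℕ.≡ᵇ j then 1# else 0#

  embℕ : ℕ → Carrier
  embℕ zero    = 0#
  embℕ (suc n) = 1# + embℕ n

  embℤ : ℤ → Carrier
  embℤ (+ n)    = embℕ n
  embℤ -[1+ n ] = - embℕ (suc n)

  -- Affine maps F_q^k → F_q^n,  x ↦ M x + b  (M given by its n rows)

  Aff : ℕ → ℕ → Set
  Aff k n = Vec (Pt k) n × Pt n

  apply : ∀ {k n} → Aff k n → Pt k → Pt n
  apply (M , b) x = vadd (Vec.map (λ row → dot row x) M) b

  affs : (k n : ℕ) → List (Aff k n)
  affs k n = cartesianProduct (vecsOf (pts k) n) (pts n)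

  Fixed : ∀ {k n} → ℕ → Aff k n → Set
  Fixed {k} {n} u φ = u ≤ suc k × u ≤ suc n × All (λ j → apply φ (unit j) ≡ unit j) (upTo u)

  Injective : ∀ {k n} → Aff k n → Set
  Injective {k} φ = All (λ x → All (λ y → apply φ x ≡ apply φ y → x ≡ y) (pts k)) (pts k)

  Surjective : ∀ {k n} → Aff k n → Set
  Surjective {k} {n} φ = All (λ y → Any (λ x → apply φ x ≡ y) (pts k)) (pts n)

  Bijective : ∀ {k n} → Aff k n → Set
  Bijective φ = Injective φ × Surjective φ

  fixed? : ∀ {k n} u → Decidable (Fixed {k} {n} u)
  fixed? {k} {n} u φ = (u ℕ.≤? suc k) ×-dec (u ℕ.≤? suc n) ×-dec all? (λ j → apply φ (unit j) ≟v unit j) (upTo u)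

  injective? : ∀ {k n} → Decidable (Injective {k} {n})
  injective? {k} φ = all? (λ x → all? (λ y → (apply φ x ≟v apply φ y) →-dec (x ≟v y)) (pts k)) (pts k)

  bijective? : ∀ {k n} → Decidable (Bijective {k} {n})
  bijective? {k} {n} φ = injective? φ ×-dec all? (λ y → any? (λ x → apply φ x ≟v y) (pts k)) (pts n)

  Mat : ℕ → ℕ → Set
  Mat r m = Vec (Vec ℤ m) r

  Lmap : ∀ {r m} → Mat r m → Pt m → Pt r
  Lmap A x = Vec.map (λ row → dot (Vec.map embℤ row) x) A

  -- full rank: rank = min(r,m), i.e. L surjective (rank r) or injective (rank m)
  FullRank : ∀ {r m} → Mat r m → Set
  FullRank {r} {m} A = (∀ (y : Pt r) → ∃ λ x → Lmap A x ≡ y)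
                     ⊎ (∀ (x y : Pt m) → Lmap A x ≡ Lmap A y → x ≡ y)

  rowApply : ∀ {m n} → Vec ℤ m → Vec (Pt n) m → Pt n
  rowApply row s = Vec.foldr _ vadd vzero (zipWith scale (Vec.map embℤ row) s)

  IsSol : ∀ {r m n} → Mat r m → Vec (Pt n) m → Set
  IsSol A s = All (λ row → rowApply row s ≡ vzero) (toList A)

  isSol? : ∀ {r m n} (A : Mat r m) → Decidable (IsSol {n = n} A)
  isSol? A s = all? (λ row → rowApply row s ≟v vzero) (toList A)

  SLNonempty : ∀ {r m} → Mat r m → ℕ → Set
  SLNonempty {m = m} A n = Σ (Vec (Pt n) m) λ s → IsSol A s × AllPairs _≢_ (toList s)

  Invariant : ∀ {r m} → Mat r m → Set
  Invariant {m = m} A = ∀ n (s : Vec (Pt n) m) (x : Pt n) → IsSol A s → IsSol A (Vec.map (vadd x) s)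

  Admissible : ∀ {r m} → Mat r m → ℤ → Set
  Admissible A t = (ℤ.0ℤ ℤ.≤ t) ⊎ (t ≡ ℤ.-1ℤ × Invariant A)

  -- some t-fixed k-dimensional subspace (image of an injective t-fixed
  -- affine map F_q^k → F_q^n) contains all entries of s
  Contained : ∀ {m n} → ℤ → (k : ℕ) → Vec (Pt n) m → Set
  Contained {n = n} t k s =
    Any (λ φ → Fixed (tplus1 t) φ × Injective φ × All (λ sj → Any (λ x → apply φ x ≡ sj) (pts k)) (toList s)) (affs k n)

  contained? : ∀ {m n} t k → Decidable (Contained {m} {n} t k)
  contained? {n = n} t k s =
    any? (λ φ → fixed? (tplus1 t) φ ×-dec injective? φ ×-dec all? (λ sj → any? (λ x → apply φ x ≟v sj) (pts k)) (toList s)) (affs k n)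

  DimIs : ∀ {m n} → ℤ → Vec (Pt n) m → ℕ → Set
  DimIs t s D = tplusPos t ≤ D × Contained t D s × All (λ k → tplusPos t ≤ k → ¬ Contained t k s) (upTo D)

  dimIs? : ∀ {m n} t D → Decidable (λ (s : Vec (Pt n) m) → DimIs t s D)
  dimIs? t D s = (tplusPos t ℕ.≤? D) ×-dec contained? t D s ×-dec all? (λ k → (tplusPos t ℕ.≤? k) →-dec ¬? (contained? t k s)) (upTo D)

  DimL : ∀ {r m} → Mat r m → ℤ → ℕ → Set
  DimL {m = m} A t D =
    (Σ ℕ λ n → Σ (Vec (Pt n) m) λ s → IsSol A s × DimIs t s D)
    × (∀ n (s : Vec (Pt n) m) D′ → IsSol A s → DimIs t s D′ → D′ ≤ D)

  countSt : ∀ {r m} (A : Mat r m) (t : ℤ) (D n : ℕ) (T : Pt n → Set) → Decidable T → ℕ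
  countSt {m = m} A t D n T T? =
    length (filter (λ s → all? T? (toList s) ×-dec isSol? A s ×-dec dimIs? t D s) (vecsOf (pts n) m))

  -- s^t_L(T) = |S^t_L(T)| / |S^t_L(F_q^n)|, where D = dim_t(L)
  sDens : ∀ {r m} (A : Mat r m) (t : ℤ) (D n : ℕ) (T : Pt n → Set) → Decidable T → ℚ
  sDens A t D n T T? = frac (countSt A t D n T T?) (countSt A t D n (λ _ → ⊤) (λ _ → yes _))

  Coloring : ℕ → ℕ → Set
  Coloring c n = Pt n → Fin c

  Class : ∀ {c n} → Coloring c n → Fin c → Pt n → Set
  Class γ i x = γ x ≡ i

  class? : ∀ {c n} (γ : Coloring c n) i → Decidable (Class γ i)
  class? γ i x = γ x Fin.≟ i

  Iso : ∀ {c n} → ℤ → Coloring c n → Coloring c n → Set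
  Iso {n = n} t γ₁ γ₂ =
    Any (λ φ → Fixed (tplus1 t) φ × Bijective φ × All (λ x → γ₁ x ≡ γ₂ (apply φ x)) (pts n)) (affs n n)

  iso? : ∀ {c n} t (γ₁ γ₂ : Coloring c n) → Dec (Iso t γ₁ γ₂)
  iso? {n = n} t γ₁ γ₂ =
    any? (λ φ → fixed? (tplus1 t) φ ×-dec bijective? φ ×-dec all? (λ x → γ₁ x Fin.≟ γ₂ (apply φ x)) (pts n)) (affs n n)

  IsColReps : ∀ {c} k → ℤ → List (Coloring c k) → Set
  IsColReps {c} k t R = (∀ (δ : Coloring c k) → Any (Iso t δ) R) × AllPairs (λ a b → ¬ Iso t a b) R

  MonEquiv : ∀ {k n} → ℤ → Aff k n → Aff k n → Set
  MonEquiv {k} t φ φ′ =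
    Any (λ ψ → Fixed (tplus1 t) ψ × Bijective ψ × All (λ x → apply φ′ x ≡ apply φ (apply ψ x)) (pts k)) (affs k k)

  IsMonReps : ∀ k n → ℤ → List (Aff k n) → Set
  IsMonReps k n t M =
    All (λ φ → Fixed (tplus1 t) φ × Injective φ) M
    × (∀ (φ : Aff k n) → Fixed (tplus1 t) φ → Injective φ → Any (MonEquiv t φ) M)
    × AllPairs (λ a b → ¬ MonEquiv t a b) M

  pt : ∀ {c k n} → ℤ → List (Aff k n) → Coloring c k → Coloring c n → ℚ
  pt t M δ γ = frac (length (filter (λ φ → iso? t (λ x → γ (apply φ x)) δ) M)) (length M)

{-# OPTIONS --safe #-}

-- Let S(T) be the solutions of L of dimension D = dim_t(L) with entries in T, and M a set of representatives of Mon_t(k;n).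
-- For a t-fixed affine injection φ of F_q^k, s ↦ φ ∘ s identifies S(T ∘ φ) with the members of S(T) lying in the image of φ:
-- admissibility makes φ preserve solutions, and preimages of fixed subspaces are fixed subspaces, so φ preserves dim_t.
-- Double counting pairs (φ, s) gives Σ_{φ ∈ M} |S(T ∘ φ)| = N |S(T)|, where N, the number of φ ∈ M whose image contains s,
-- is the same for all s ∈ S(F_q^n): the image of φ contains s iff it contains the D-dimensional fixed subspace through s,
-- and two such subspaces differ by a t-fixed automorphism g of F_q^n, while φ ↦ g ∘ φ permutes the classes of Mon_t(k;n).
-- For T = γ⁽ⁱ⁾, grouping the φ by the class of γ ∘ φ in Γ^t(k) turns the left-hand side into Σ_δ |S(δ⁽ⁱ⁾)| · #{φ : γ ∘ φ ≅_t δ};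
-- for T = F_q^n it is |M| · |S(F_q^k)|. Dividing the two identities gives the formula.

module Submission where

open import Defs using (FiniteField; Mat; Admissible)
open import Data.Integer using (ℤ)
open import Data.Nat using (ℕ)

module Counting where

  open import Defs using (vecsOf)
  open import Data.Nat using (ℕ; zero; suc; _+_; _*_; _^_; _≤_; _<_; z≤n; s≤s)
  import Data.Nat.Properties as ℕ
  open import Algebra.Properties.CommutativeSemigroup ℕ.+-commutativeSemigroup using () renaming (interchange to +-interchange)
  open import Data.Nat.ListAction using (sum)
  open import Data.List using (List; []; _∷_; _++_; length; filter; map; concatMap; cartesianProductWith)
  open import Data.Vec as Vec using (Vec; []; _∷_; toList)
  import Data.Vec.Properties as Vecₚ
  open import Data.List.Properties using (length-++; length-map; map-cong-local)
  open import Data.List.Membership.Propositional using (_∈_; _∉_; find)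
  open import Data.List.Relation.Binary.Subset.Propositional using (_⊆_)
  open import Data.List.Membership.Propositional.Properties
    using (∈-∃++; ∈-++⁻; ∈-++⁺ˡ; ∈-++⁺ʳ; ∈-map⁺; ∈-map⁻; ∈-filter⁺; ∈-filter⁻; ∈-cartesianProductWith⁺)
  open import Data.List.Relation.Unary.All as All using (All; []; _∷_)
  open import Data.List.Relation.Unary.Any using (Any; here; there)
  open import Data.List.Relation.Unary.AllPairs using (AllPairs; []; _∷_)
  open import Data.List.Relation.Unary.Unique.Propositional using (Unique)
  import Data.List.Relation.Unary.Unique.Propositional.Properties as Unique
  open import Data.Product using (Σ; _×_; _,_; proj₂)
  open import Data.Sum using (inj₁; inj₂)
  open import Data.Empty using (⊥-elim)
  open import Function using (Injective; _∘_; id)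
  open import Relation.Nullary using (¬_; Dec; yes; no; _×-dec_)
  open import Relation.Unary using (Decidable)
  open import Relation.Binary.PropositionalEquality

  module _ {A : Set} where

    length-mono-⊆ : {xs ys : List A} → Unique xs → xs ⊆ ys → length xs ≤ length ys
    length-mono-⊆ {[]} _ _ = z≤n
    length-mono-⊆ {x ∷ xs} {ys} (x∉xs ∷ uxs) xs⊆ys with ∈-∃++ (xs⊆ys (here refl))
    ... | ys₁ , ys₂ , refl = begin
      suc (length xs)              ≤⟨ s≤s (length-mono-⊆ uxs xs⊆ys₁++ys₂) ⟩
      suc (length (ys₁ ++ ys₂))    ≡⟨ cong suc (length-++ ys₁) ⟩
      suc (length ys₁ + length ys₂) ≡⟨ ℕ.+-suc (length ys₁) (length ys₂) ⟨
      length ys₁ + length (x ∷ ys₂) ≡⟨ length-++ ys₁ ⟨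
      length (ys₁ ++ x ∷ ys₂)      ∎
      where
      open ℕ.≤-Reasoning
      xs⊆ys₁++ys₂ : xs ⊆ (ys₁ ++ ys₂)
      xs⊆ys₁++ys₂ z∈xs with ∈-++⁻ ys₁ (xs⊆ys (there z∈xs))
      ... | inj₁ z∈ys₁ = ∈-++⁺ˡ z∈ys₁
      ... | inj₂ (there z∈ys₂) = ∈-++⁺ʳ ys₁ z∈ys₂
      ... | inj₂ (here refl) = ⊥-elim (All.lookup x∉xs z∈xs refl)

    length-strictMono-⊆ : {xs ys : List A} {y : A} →
                          Unique xs → xs ⊆ ys → y ∈ ys → y ∉ xs → length xs < length ys
    length-strictMono-⊆ {xs} {ys} {y} uxs xs⊆ys y∈ys y∉xs =
      length-mono-⊆ (All.tabulate (λ x∈xs y≡x → y∉xs (subst (_∈ xs) (sym y≡x) x∈xs)) ∷ uxs) y∷xs⊆ys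
      where
      y∷xs⊆ys : (y ∷ xs) ⊆ ys
      y∷xs⊆ys (here refl) = y∈ys
      y∷xs⊆ys (there x∈xs) = xs⊆ys x∈xs

    length-⊆-antisym : {xs ys : List A} → Unique xs → Unique ys → xs ⊆ ys → ys ⊆ xs → length xs ≡ length ys
    length-⊆-antisym uxs uys xs⊆ys ys⊆xs = ℕ.≤-antisym (length-mono-⊆ uxs xs⊆ys) (length-mono-⊆ uys ys⊆xs)

  count : {A : Set} {P : A → Set} → Decidable P → List A → ℕ
  count P? xs = length (filter P? xs)

  indicator : {A : Set} {P : A → Set} → Decidable P → A → ℕ
  indicator P? x with P? x
  ... | yes _ = 1
  ... | no _ = 0

  count≡sum-indicator : {A : Set} {P : A → Set} (P? : Decidable P) (xs : List A) → count P? xs ≡ sum (map (indicator P?) xs)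
  count≡sum-indicator P? [] = refl
  count≡sum-indicator P? (x ∷ xs) with P? x
  ... | yes _ = cong suc (count≡sum-indicator P? xs)
  ... | no _ = count≡sum-indicator P? xs

  indicator-cong : {A B : Set} {P : A → Set} {Q : B → Set} (P? : Decidable P) (Q? : Decidable Q) {x : A} {y : B} →
                   (P x → Q y) → (Q y → P x) → indicator P? x ≡ indicator Q? y
  indicator-cong P? Q? {x} {y} P⇒Q Q⇒P with P? x | Q? y
  ... | yes _ | yes _ = refl
  ... | no _ | no _ = refl
  ... | yes p | no ¬q = ⊥-elim (¬q (P⇒Q p))
  ... | no ¬p | yes q = ⊥-elim (¬p (Q⇒P q))

  indicator-×-dec : {A : Set} {P Q : A → Set} (P? : Decidable P) (Q? : Decidable Q) (x : A) →
                    indicator (λ y → P? y ×-dec Q? y) x ≡ indicator P? x * indicator Q? x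
  indicator-×-dec P? Q? x with P? x | Q? x
  ... | yes _ | yes _ = refl
  ... | yes _ | no _ = refl
  ... | no _ | yes _ = refl
  ... | no _ | no _ = refl

  *-indicator-cong : {A : Set} {P : A → Set} (P? : Decidable P) (x : A) {c d : ℕ} → (P x → c ≡ d) → c * indicator P? x ≡ d * indicator P? x
  *-indicator-cong P? x {c} {d} P⇒c≡d with P? x
  ... | yes p = cong (_* 1) (P⇒c≡d p)
  ... | no _ = trans (ℕ.*-zeroʳ c) (sym (ℕ.*-zeroʳ d))

  count-cong : {A : Set} {P Q : A → Set} (P? : Decidable P) (Q? : Decidable Q) (xs : List A) →
               (∀ {x} → x ∈ xs → P x → Q x) → (∀ {x} → x ∈ xs → Q x → P x) → count P? xs ≡ count Q? xs
  count-cong P? Q? xs P⇒Q Q⇒P = begin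
    count P? xs                 ≡⟨ count≡sum-indicator P? xs ⟩
    sum (map (indicator P?) xs) ≡⟨ cong sum (map-cong-local (All.tabulate λ x∈xs → indicator-cong P? Q? (P⇒Q x∈xs) (Q⇒P x∈xs))) ⟩
    sum (map (indicator Q?) xs) ≡⟨ count≡sum-indicator Q? xs ⟨
    count Q? xs                 ∎
    where open ≡-Reasoning

  count-map : {A B : Set} {P : B → Set} (P? : Decidable P) (f : A → B) (xs : List A) →
              count P? (map f xs) ≡ count (P? ∘ f) xs
  count-map P? f [] = refl
  count-map P? f (x ∷ xs) with P? (f x)
  ... | yes _ = cong suc (count-map P? f xs)
  ... | no _ = count-map P? f xs

  count-injection : {A B : Set} {P : A → Set} {Q : B → Set} (P? : Decidable P) (Q? : Decidable Q)
                    {xs : List A} {ys : List B} → Unique xs → Unique ys → (∀ x → x ∈ xs) → (∀ y → y ∈ ys) →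
                    (f : A → B) → Injective _≡_ _≡_ f →
                    (∀ {x} → P x → Q (f x)) → (∀ {y} → Q y → Σ A λ x → P x × f x ≡ y) → count P? xs ≡ count Q? ys
  count-injection P? Q? {xs} {ys} uxs uys ∈xs ∈ys f f-inj P⇒Q Q⇒P = begin
    length (filter P? xs)         ≡⟨ length-map f (filter P? xs) ⟨
    length (map f (filter P? xs)) ≡⟨ length-⊆-antisym (Unique.map⁺ f-inj (Unique.filter⁺ P? uxs)) (Unique.filter⁺ Q? uys) image⊆ ⊆image ⟩
    length (filter Q? ys)         ∎
    where
    open ≡-Reasoning
    image⊆ : map f (filter P? xs) ⊆ filter Q? ys
    image⊆ y∈ with ∈-map⁻ f y∈
    ... | x , x∈ , refl = ∈-filter⁺ Q? (∈ys (f x)) (P⇒Q (proj₂ (∈-filter⁻ P? {xs = xs} x∈)))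
    ⊆image : filter Q? ys ⊆ map f (filter P? xs)
    ⊆image {y} y∈ with Q⇒P (proj₂ (∈-filter⁻ Q? {xs = ys} y∈))
    ... | x , px , refl = ∈-map⁺ f (∈-filter⁺ P? (∈xs x) px)

  module _ {A : Set} where

    sum-map-+ : (f g : A → ℕ) (xs : List A) → sum (map (λ x → f x + g x) xs) ≡ sum (map f xs) + sum (map g xs)
    sum-map-+ f g [] = refl
    sum-map-+ f g (x ∷ xs) = trans (cong (f x + g x +_) (sum-map-+ f g xs)) (+-interchange (f x) (g x) _ _)

    sum-map-*ˡ : (c : ℕ) (f : A → ℕ) (xs : List A) → sum (map (λ x → c * f x) xs) ≡ c * sum (map f xs)
    sum-map-*ˡ c f [] = sym (ℕ.*-zeroʳ c)
    sum-map-*ˡ c f (x ∷ xs) = trans (cong (c * f x +_) (sum-map-*ˡ c f xs)) (sym (ℕ.*-distribˡ-+ c (f x) _))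

    sum-map-const : (c : ℕ) (xs : List A) → sum (map (λ _ → c) xs) ≡ length xs * c
    sum-map-const c [] = refl
    sum-map-const c (x ∷ xs) = cong (c +_) (sum-map-const c xs)

  sum-map-comm : {A B : Set} (f : A → B → ℕ) (xs : List A) (ys : List B) →
                 sum (map (λ x → sum (map (f x) ys)) xs) ≡ sum (map (λ y → sum (map (λ x → f x y) xs)) ys)
  sum-map-comm f [] ys = sym (trans (sum-map-const 0 ys) (ℕ.*-zeroʳ (length ys)))
  sum-map-comm f (x ∷ xs) ys = trans (cong (sum (map (f x) ys) +_) (sum-map-comm f xs ys))
                                     (sym (sum-map-+ (f x) (λ y → sum (map (λ x → f x y) xs)) ys))

  sum-map-*ʳ : {A : Set} (f : A → ℕ) (c : ℕ) (xs : List A) → sum (map (λ x → f x * c) xs) ≡ sum (map f xs) * c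
  sum-map-*ʳ f c xs = begin
    sum (map (λ x → f x * c) xs) ≡⟨ cong sum (map-cong-local {xs = xs} (All.tabulate λ {x} _ → ℕ.*-comm (f x) c)) ⟩
    sum (map (λ x → c * f x) xs) ≡⟨ sum-map-*ˡ c f xs ⟩
    c * sum (map f xs)           ≡⟨ ℕ.*-comm c _ ⟩
    sum (map f xs) * c           ∎
    where open ≡-Reasoning

  double-counting : {A B : Set} {P : A → Set} {R : A → B → Set} (P? : Decidable P) (R? : ∀ x y → Dec (R x y))
                    (xs : List A) (ys : List B) →
                    sum (map (λ y → count (λ x → P? x ×-dec R? x y) xs) ys) ≡ sum (map (λ x → count (R? x) ys * indicator P? x) xs)
  double-counting P? R? xs ys = begin
    sum (map (λ y → count (λ x → P? x ×-dec R? x y) xs) ys)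
      ≡⟨ cong sum (map-cong-local {xs = ys} (All.tabulate λ {y} _ → trans (count≡sum-indicator _ xs)
           (cong sum (map-cong-local {xs = xs} (All.tabulate λ {x} _ → pair x y))))) ⟩
    sum (map (λ y → sum (map (λ x → indicator (R? x) y * indicator P? x) xs)) ys)
      ≡⟨ sum-map-comm (λ x y → indicator (R? x) y * indicator P? x) xs ys ⟨
    sum (map (λ x → sum (map (λ y → indicator (R? x) y * indicator P? x) ys)) xs)
      ≡⟨ cong sum (map-cong-local {xs = xs} (All.tabulate λ {x} _ →
           trans (sum-map-*ʳ (indicator (R? x)) (indicator P? x) ys) (cong (_* indicator P? x) (sym (count≡sum-indicator (R? x) ys))))) ⟩
    sum (map (λ x → count (R? x) ys * indicator P? x) xs) ∎
    where
    open ≡-Reasoning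
    pair : ∀ x y → indicator (λ x → P? x ×-dec R? x y) x ≡ indicator (R? x) y * indicator P? x
    pair x y = trans (indicator-×-dec P? (λ x → R? x y) x)
                     (trans (ℕ.*-comm (indicator P? x) _) (cong (_* indicator P? x) (indicator-cong (λ x → R? x y) (R? x) id id)))

  module Transversal {A : Set} (_~_ : A → A → Set) (_~?_ : ∀ x y → Dec (x ~ y))
                     (~-sym : ∀ {x y} → x ~ y → y ~ x) (~-trans : ∀ {x y z} → x ~ y → y ~ z → x ~ z) where

    Irredundant : List A → Set
    Irredundant = AllPairs (λ x y → ¬ x ~ y)

    sum-transversal : (f : A → ℕ) {R : List A} {x : A} → Irredundant R → Any (x ~_) R →
                      (∀ {y} → x ~ y → f y ≡ f x) → sum (map (λ y → indicator (x ~?_) y * f y) R) ≡ f x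
    sum-transversal f {y ∷ R} {x} (y≁R ∷ _) (here x~y) f-resp with x ~? y
    ... | no x≁y = ⊥-elim (x≁y x~y)
    ... | yes _ = trans (cong₂ _+_ (trans (ℕ.+-identityʳ (f y)) (f-resp x~y)) (vanish R y≁R)) (ℕ.+-identityʳ (f x))
      where
      vanish : ∀ R′ → All (λ z → ¬ y ~ z) R′ → sum (map (λ z → indicator (x ~?_) z * f z) R′) ≡ 0
      vanish [] [] = refl
      vanish (z ∷ R′) (y≁z ∷ y≁R′) with x ~? z
      ... | yes x~z = ⊥-elim (y≁z (~-trans (~-sym x~y) x~z))
      ... | no _ = vanish R′ y≁R′
    sum-transversal f {y ∷ R} {x} (y≁R ∷ irr) (there x~R) f-resp with x ~? y
    ... | no _ = sum-transversal f irr x~R f-resp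
    ... | yes x~y with find x~R
    ...   | z , z∈R , x~z = ⊥-elim (All.lookup y≁R z∈R (~-trans (~-sym x~y) x~z))

    count-transversal : {P : A → Set} (P? : Decidable P) → (∀ {x y} → x ~ y → P x → P y) →
                        {xs ys : List A} → Irredundant xs → Irredundant ys →
                        (∀ {x} → x ∈ xs → Any (x ~_) ys) → (∀ {y} → y ∈ ys → Any (y ~_) xs) →
                        count P? xs ≡ count P? ys
    count-transversal P? P-resp {xs} {ys} irr-xs irr-ys xs→ys ys→xs = begin
      count P? xs
        ≡⟨ count≡sum-indicator P? xs ⟩
      sum (map [P] xs)
        ≡⟨ cong sum (map-cong-local (All.tabulate λ x∈xs →
             sym (sum-transversal [P] irr-ys (xs→ys x∈xs) (λ x~y → indicator-cong P? P? (P-resp (~-sym x~y)) (P-resp x~y))))) ⟩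
      sum (map (λ x → sum (map (λ y → indicator (x ~?_) y * [P] y) ys)) xs)
        ≡⟨ sum-map-comm (λ x y → indicator (x ~?_) y * [P] y) xs ys ⟩
      sum (map (λ y → sum (map (λ x → indicator (x ~?_) y * [P] y) xs)) ys)
        ≡⟨ cong sum (map-cong-local (All.tabulate λ {y} y∈ys → trans (cong sum (map-cong-local {xs = xs} (All.tabulate λ _ → ℕ.*-comm _ ([P] y))))
             (trans (sum-map-*ˡ ([P] y) _ xs) (trans (cong ([P] y *_) (classSize y∈ys)) (ℕ.*-identityʳ ([P] y)))))) ⟩
      sum (map [P] ys)
        ≡⟨ count≡sum-indicator P? ys ⟨
      count P? ys ∎
      where
      open ≡-Reasoning
      [P] : A → ℕ
      [P] = indicator P?
      classSize : ∀ {y} → y ∈ ys → sum (map (λ x → indicator (x ~?_) y) xs) ≡ 1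
      classSize {y} y∈ys = begin
        sum (map (λ x → indicator (x ~?_) y) xs)
          ≡⟨ cong sum (map-cong-local {xs = xs} (All.tabulate λ {x} _ →
               trans (indicator-cong (x ~?_) (y ~?_) ~-sym ~-sym) (sym (ℕ.*-identityʳ _)))) ⟩
        sum (map (λ x → indicator (y ~?_) x * 1) xs)
          ≡⟨ sum-transversal (λ _ → 1) irr-xs (ys→xs y∈ys) (λ _ → refl) ⟩
        1 ∎

  module _ {A : Set} where

    length-cartesianProductWith : {B C : Set} (f : A → B → C) (xs : List A) (ys : List B) →
                                  length (cartesianProductWith f xs ys) ≡ length xs * length ys
    length-cartesianProductWith f [] ys = refl
    length-cartesianProductWith f (x ∷ xs) ys = begin
      length (map (f x) ys ++ cartesianProductWith f xs ys)        ≡⟨ length-++ (map (f x) ys) ⟩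
      length (map (f x) ys) + length (cartesianProductWith f xs ys) ≡⟨ cong₂ _+_ (length-map (f x) ys) (length-cartesianProductWith f xs ys) ⟩
      length ys + length xs * length ys                            ∎
      where open ≡-Reasoning

    vecsOf-suc : (xs : List A) (n : ℕ) → vecsOf xs (suc n) ≡ cartesianProductWith _∷_ xs (vecsOf xs n)
    vecsOf-suc xs n = concatMap≡cartesianProductWith xs
      where
      concatMap≡cartesianProductWith : ∀ ys → concatMap (λ y → map (y ∷_) (vecsOf xs n)) ys ≡ cartesianProductWith _∷_ ys (vecsOf xs n)
      concatMap≡cartesianProductWith [] = refl
      concatMap≡cartesianProductWith (y ∷ ys) = cong (map (y ∷_) (vecsOf xs n) ++_) (concatMap≡cartesianProductWith ys)

    vecsOf-complete : {xs : List A} → (∀ a → a ∈ xs) → ∀ {n} (v : Vec A n) → v ∈ vecsOf xs n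
    vecsOf-complete ∈xs [] = here refl
    vecsOf-complete {xs} ∈xs {suc n} (a ∷ v) =
      subst ((a ∷ v) ∈_) (sym (vecsOf-suc xs n)) (∈-cartesianProductWith⁺ _∷_ (∈xs a) (vecsOf-complete ∈xs v))

    vecsOf-unique : {xs : List A} → Unique xs → ∀ n → Unique (vecsOf xs n)
    vecsOf-unique uxs zero = [] ∷ []
    vecsOf-unique {xs} uxs (suc n) =
      subst Unique (sym (vecsOf-suc xs n)) (Unique.cartesianProductWith⁺ _∷_ Vecₚ.∷-injective uxs (vecsOf-unique uxs n))

    vecsOf-length : (xs : List A) (n : ℕ) → length (vecsOf xs n) ≡ length xs ^ n
    vecsOf-length xs zero = refl
    vecsOf-length xs (suc n) =
      trans (cong length (vecsOf-suc xs n)) (trans (length-cartesianProductWith _∷_ xs (vecsOf xs n)) (cong (length xs *_) (vecsOf-length xs n)))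

  module _ {A B : Set} {P : B → Set} (f : A → B) where

    All-toList-map⁺ : ∀ {m} {s : Vec A m} → All (P ∘ f) (toList s) → All P (toList (Vec.map f s))
    All-toList-map⁺ {s = []} [] = []
    All-toList-map⁺ {s = x ∷ s} (p ∷ ps) = p ∷ All-toList-map⁺ ps

    All-toList-map⁻ : ∀ {m} {s : Vec A m} → All P (toList (Vec.map f s)) → All (P ∘ f) (toList s)
    All-toList-map⁻ {s = []} [] = []
    All-toList-map⁻ {s = x ∷ s} (p ∷ ps) = p ∷ All-toList-map⁻ ps

module FieldArithmetic (F : FiniteField) where

  open import Defs using (FiniteField; embℕ; embℤ)
  open import Algebra.Bundles using (CommutativeRing)
  open import Algebra.Solver.Ring.AlmostCommutativeRing using (fromCommutativeRing; _-Raw-AlmostCommutative⟶_)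
  open import Data.Nat as ℕ using (ℕ; zero; suc)
  open import Data.Integer as ℤ using (ℤ; -[1+_]; _⊖_)
  import Data.Nat.Properties as ℕ
  import Data.Integer.Properties as ℤ
  import Data.Maybe as Maybe
  open import Relation.Nullary.Decidable using (dec⇒maybe)
  open import Relation.Binary.PropositionalEquality
  open ≡-Reasoning

  commutativeRing : CommutativeRing _ _
  commutativeRing = record { isCommutativeRing = FiniteField.isCommutativeRing F }

  open CommutativeRing commutativeRing
    using (Carrier; _+_; _*_; -_; _-_; 0#; 1#; ring; semiring; +-commutativeSemigroup; +-comm; +-identityˡ; +-identityʳ; -‿inverseʳ)
  open import Algebra.Properties.Ring ring using (-0#≈0#; -‿+-comm; -‿involutive; -‿distribˡ-*; -‿distribʳ-*)
  open import Algebra.Properties.CommutativeSemigroup +-commutativeSemigroup using (interchange)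
  open import Algebra.Properties.Semiring.Mult semiring using (_×_; ×-homo-+; ×1-homo-*)

  embℕ≡×1# : ∀ n → embℕ F n ≡ n × 1#
  embℕ≡×1# zero = refl
  embℕ≡×1# (suc n) = cong (1# +_) (embℕ≡×1# n)

  embℕ-+ : ∀ m n → embℕ F (m ℕ.+ n) ≡ embℕ F m + embℕ F n
  embℕ-+ m n = begin
    embℕ F (m ℕ.+ n)         ≡⟨ embℕ≡×1# (m ℕ.+ n) ⟩
    (m ℕ.+ n) × 1#           ≡⟨ ×-homo-+ 1# m n ⟩
    m × 1# + n × 1#          ≡⟨ cong₂ _+_ (embℕ≡×1# m) (embℕ≡×1# n) ⟨
    embℕ F m + embℕ F n      ∎

  embℕ-* : ∀ m n → embℕ F (m ℕ.* n) ≡ embℕ F m * embℕ F n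
  embℕ-* m n = begin
    embℕ F (m ℕ.* n)         ≡⟨ embℕ≡×1# (m ℕ.* n) ⟩
    (m ℕ.* n) × 1#           ≡⟨ ×1-homo-* m n ⟩
    m × 1# * n × 1#          ≡⟨ cong₂ _*_ (embℕ≡×1# m) (embℕ≡×1# n) ⟨
    embℕ F m * embℕ F n      ∎

  embℤ-neg : ∀ i → embℤ F (ℤ.- i) ≡ - embℤ F i
  embℤ-neg (ℤ.+ zero) = sym -0#≈0#
  embℤ-neg (ℤ.+ suc n) = refl
  embℤ-neg -[1+ n ] = sym (-‿involutive _)

  embℤ-⊖ : ∀ m n → embℤ F (m ⊖ n) ≡ embℕ F m - embℕ F n
  embℤ-⊖ zero zero = sym (trans (cong (0# +_) -0#≈0#) (+-identityʳ 0#))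
  embℤ-⊖ zero (suc n) = sym (+-identityˡ _)
  embℤ-⊖ (suc m) zero = sym (trans (cong (embℕ F (suc m) +_) -0#≈0#) (+-identityʳ _))
  embℤ-⊖ (suc m) (suc n) = begin
    embℤ F (suc m ⊖ suc n)              ≡⟨ cong (embℤ F) (ℤ.[1+m]⊖[1+n]≡m⊖n m n) ⟩
    embℤ F (m ⊖ n)                      ≡⟨ embℤ-⊖ m n ⟩
    a - b                               ≡⟨ +-identityˡ (a - b) ⟨
    0# + (a - b)                        ≡⟨ cong (_+ (a - b)) (-‿inverseʳ 1#) ⟨
    (1# - 1#) + (a - b)                 ≡⟨ interchange 1# (- 1#) a (- b) ⟩
    (1# + a) + (- 1# + - b)             ≡⟨ cong ((1# + a) +_) (-‿+-comm 1# b) ⟩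
    (1# + a) - (1# + b)                 ∎
    where
    a b : Carrier
    a = embℕ F m
    b = embℕ F n

  embℤ-+ : ∀ i j → embℤ F (i ℤ.+ j) ≡ embℤ F i + embℤ F j
  embℤ-+ (ℤ.+ m) (ℤ.+ n) = embℕ-+ m n
  embℤ-+ (ℤ.+ m) -[1+ n ] = embℤ-⊖ m (suc n)
  embℤ-+ -[1+ m ] (ℤ.+ n) = trans (embℤ-⊖ n (suc m)) (+-comm _ _)
  embℤ-+ -[1+ m ] -[1+ n ] = begin
    - embℕ F (suc (suc (m ℕ.+ n)))                ≡⟨ cong (λ k → - embℕ F k) (ℕ.+-suc (suc m) n) ⟨
    - embℕ F (suc m ℕ.+ suc n)                    ≡⟨ cong -_ (embℕ-+ (suc m) (suc n)) ⟩
    - (embℕ F (suc m) + embℕ F (suc n))           ≡⟨ -‿+-comm _ _ ⟨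
    - embℕ F (suc m) + - embℕ F (suc n)           ∎
    where import Data.Nat.Properties as ℕ

  embℤ-*-pos : ∀ m j → embℤ F (ℤ.+ m ℤ.* j) ≡ embℕ F m * embℤ F j
  embℤ-*-pos m (ℤ.+ n) = trans (cong (embℤ F) (sym (ℤ.pos-* m n))) (embℕ-* m n)
  embℤ-*-pos m -[1+ n ] = begin
    embℤ F (ℤ.+ m ℤ.* ℤ.- ℤ.+ suc n)       ≡⟨ cong (embℤ F) (ℤ.neg-distribʳ-* (ℤ.+ m) (ℤ.+ suc n)) ⟨
    embℤ F (ℤ.- (ℤ.+ m ℤ.* ℤ.+ suc n))     ≡⟨ embℤ-neg (ℤ.+ m ℤ.* ℤ.+ suc n) ⟩
    - embℤ F (ℤ.+ m ℤ.* ℤ.+ suc n)         ≡⟨ cong -_ (embℤ-*-pos m (ℤ.+ suc n)) ⟩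
    - (embℕ F m * embℕ F (suc n))          ≡⟨ -‿distribʳ-* _ _ ⟩
    embℕ F m * - embℕ F (suc n)            ∎

  embℤ-* : ∀ i j → embℤ F (i ℤ.* j) ≡ embℤ F i * embℤ F j
  embℤ-* (ℤ.+ m) j = embℤ-*-pos m j
  embℤ-* -[1+ m ] j = begin
    embℤ F (ℤ.- ℤ.+ suc m ℤ.* j)           ≡⟨ cong (embℤ F) (ℤ.neg-distribˡ-* (ℤ.+ suc m) j) ⟨
    embℤ F (ℤ.- (ℤ.+ suc m ℤ.* j))         ≡⟨ embℤ-neg (ℤ.+ suc m ℤ.* j) ⟩
    - embℤ F (ℤ.+ suc m ℤ.* j)             ≡⟨ cong -_ (embℤ-*-pos (suc m) j) ⟩
    - (embℕ F (suc m) * embℤ F j)          ≡⟨ -‿distribˡ-* _ _ ⟩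
    - embℕ F (suc m) * embℤ F j            ∎

  -- The ring solver needs coefficients whose arithmetic computes; ℤ, mapped into F by embℤ, serves.
  embℤ-homomorphism : ℤ.+-*-rawRing -Raw-AlmostCommutative⟶ fromCommutativeRing commutativeRing
  embℤ-homomorphism = record
    { ⟦_⟧ = embℤ F
    ; +-homo = embℤ-+
    ; *-homo = embℤ-*
    ; -‿homo = embℤ-neg
    ; 0-homo = refl
    ; 1-homo = +-identityʳ 1#
    }

  open import Algebra.Solver.Ring ℤ.+-*-rawRing (fromCommutativeRing commutativeRing) embℤ-homomorphism
    (λ i j → Maybe.map (cong (embℤ F)) (dec⇒maybe (i ℤ.≟ j))) public
    using (solve; _:=_; _:+_; _:*_; _:-_; con)

module AffineMaps (F : FiniteField) where

  open import Defs using (FiniteField; unit)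
  open FieldArithmetic F
  open import Algebra.Bundles using (CommutativeRing)
  open import Data.Nat as ℕ using (ℕ; zero; suc; _≤_; _<_; _∸_; z≤n; s≤s)
  import Data.Nat.Properties as ℕ
  open import Data.Integer using (0ℤ)
  open import Data.Vec using (Vec; []; _∷_; _∷ʳ_; replicate; initLast)
  import Data.Vec.Properties as Vec
  open import Data.Product using (Σ; _,_)
  open import Function using (Injective; _∘_)
  open import Relation.Binary.PropositionalEquality
  open ≡-Reasoning

  open FiniteField F using (Carrier; 0#; 1#)
  open CommutativeRing commutativeRing using (_+_; _*_; -_; _-_; *-identityˡ)

  V : ℕ → Set
  V = Vec Carrier

  0v : ∀ {n} → V n
  0v = replicate _ 0#

  e : ∀ {n} → ℕ → V n
  e = unit F

  e₀≡0v : ∀ {n} → e {n} 0 ≡ 0v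
  e₀≡0v {zero} = refl
  e₀≡0v {suc n} = cong (0# ∷_) (e₀≡0v {n})

  comb : ∀ {n} → V n → Carrier → V n → V n → V n
  comb [] a [] [] = []
  comb (x ∷ xs) a (y ∷ ys) (z ∷ zs) = x + a * (y - z) ∷ comb xs a ys zs

  comb-0# : ∀ {n} (x y z : V n) → comb x 0# y z ≡ x
  comb-0# [] [] [] = refl
  comb-0# (x ∷ xs) (y ∷ ys) (z ∷ zs) =
    cong₂ _∷_ (solve 3 (λ x y z → x :+ con 0ℤ :* (y :- z) := x) refl x y z) (comb-0# xs ys zs)

  comb-diag : ∀ {n} (x : V n) a y → comb x a y y ≡ x
  comb-diag [] a [] = refl
  comb-diag (x ∷ xs) a (y ∷ ys) =
    cong₂ _∷_ (solve 3 (λ x a y → x :+ a :* (y :- y) := x) refl x a y) (comb-diag xs a ys)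

  comb-cancelˡ : ∀ {n} {x x′ : V n} a y z → comb x a y z ≡ comb x′ a y z → x ≡ x′
  comb-cancelˡ {x = []} {[]} a [] [] _ = refl
  comb-cancelˡ {x = x ∷ xs} {x′ ∷ xs′} a (y ∷ ys) (z ∷ zs) eq = cong₂ _∷_ head (comb-cancelˡ a ys zs (Vec.∷-injectiveʳ eq))
    where
    head : x ≡ x′
    head = begin
      x                                        ≡⟨ solve 4 (λ x a y z → x := x :+ a :* (y :- z) :- a :* (y :- z)) refl x a y z ⟩
      x + a * (y - z) - a * (y - z)            ≡⟨ cong (_- a * (y - z)) (Vec.∷-injectiveˡ eq) ⟩
      x′ + a * (y - z) - a * (y - z)           ≡⟨ solve 4 (λ x a y z → x :+ a :* (y :- z) :- a :* (y :- z) := x) refl x′ a y z ⟩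
      x′                                       ∎

  comb-interchange : ∀ {n} (x y z w p : V n) a b c d →
                     comb (comb x a y z) (b + a * (c - d)) w p ≡ comb (comb x b w p) a (comb y c w p) (comb z d w p)
  comb-interchange [] [] [] [] [] a b c d = refl
  comb-interchange (x ∷ xs) (y ∷ ys) (z ∷ zs) (w ∷ ws) (p ∷ ps) a b c d = cong₂ _∷_
    (solve 9 (λ x y z w p a b c d → (x :+ a :* (y :- z)) :+ (b :+ a :* (c :- d)) :* (w :- p)
                                     := (x :+ b :* (w :- p)) :+ a :* ((y :+ c :* (w :- p)) :- (z :+ d :* (w :- p))))
       refl x y z w p a b c d)
    (comb-interchange xs ys zs ws ps a b c d)

  comb-∷ʳ : ∀ {n} (x y z : V n) a b c d → comb (x ∷ʳ b) a (y ∷ʳ c) (z ∷ʳ d) ≡ comb x a y z ∷ʳ (b + a * (c - d))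
  comb-∷ʳ [] [] [] a b c d = refl
  comb-∷ʳ (x ∷ xs) (y ∷ ys) (z ∷ zs) a b c d = cong (_ ∷_) (comb-∷ʳ xs ys zs a b c d)

  comb-solve : ∀ {n} {x y w p : V n} {a b c} → (a - b) * c ≡ 1# → comb x a w p ≡ comb y b w p → w ≡ comb p c y x
  comb-solve {x = []} {[]} {[]} {[]} _ _ = refl
  comb-solve {x = x ∷ xs} {y ∷ ys} {w ∷ ws} {p ∷ ps} {a} {b} {c} inv eq =
    cong₂ _∷_ (sym head) (comb-solve inv (Vec.∷-injectiveʳ eq))
    where
    head : p + c * (y - x) ≡ w
    head = begin
      p + c * (y - x)                                         ≡⟨ solve 7 (λ p c y x w a b → p :+ c :* (y :- x)
                                                                   := p :+ c :* ((y :+ b :* (w :- p)) :- (x :+ b :* (w :- p))))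
                                                                   refl p c y x w a b ⟩
      p + c * ((y + b * (w - p)) - (x + b * (w - p)))         ≡⟨ cong (λ t → p + c * (t - (x + b * (w - p)))) (Vec.∷-injectiveˡ eq) ⟨
      p + c * ((x + a * (w - p)) - (x + b * (w - p)))         ≡⟨ solve 7 (λ p c y x w a b → p :+ c :* ((x :+ a :* (w :- p)) :- (x :+ b :* (w :- p)))
                                                                   := p :+ ((a :- b) :* c) :* (w :- p))
                                                                   refl p c y x w a b ⟩
      p + ((a - b) * c) * (w - p)                             ≡⟨ cong (λ t → p + t * (w - p)) inv ⟩
      p + 1# * (w - p)                                        ≡⟨ cong (p +_) (*-identityˡ (w - p)) ⟩
      p + (w - p)                                             ≡⟨ solve 2 (λ p w → p :+ (w :- p) := w) refl p w ⟩
      w                                                       ∎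

  IsAffine : ∀ {k n} → (V k → V n) → Set
  IsAffine f = ∀ x a y z → f (comb x a y z) ≡ comb (f x) a (f y) (f z)

  Im : ∀ {k n} → (V k → V n) → V n → Set
  Im {k} f y = Σ (V k) λ x → f x ≡ y

  affine-∘ : ∀ {k l n} {g : V l → V n} {f : V k → V l} → IsAffine g → IsAffine f → IsAffine (g ∘ f)
  affine-∘ {g = g} {f} g-affine f-affine x a y z = trans (cong g (f-affine x a y z)) (g-affine (f x) a (f y) (f z))

  affine-≗ : ∀ {k n} {f g : V k → V n} → IsAffine f → (∀ x → g x ≡ f x) → IsAffine g
  affine-≗ {f = f} {g} f-affine g≗f x a y z = begin
    g (comb x a y z)             ≡⟨ g≗f _ ⟩
    f (comb x a y z)             ≡⟨ f-affine x a y z ⟩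
    comb (f x) a (f y) (f z)     ≡⟨ cong₂ (λ s t → comb s a t (f z)) (g≗f x) (g≗f y) ⟨
    comb (g x) a (g y) (f z)     ≡⟨ cong (comb (g x) a (g y)) (g≗f z) ⟨
    comb (g x) a (g y) (g z)     ∎

  record Fixes (u : ℕ) {k n : ℕ} (f : V k → V n) : Set where
    field
      u≤1+k : u ≤ suc k
      u≤1+n : u ≤ suc n
      fixes : ∀ j → j < u → f (e j) ≡ e j

  record IsFixedMono (u : ℕ) {k n : ℕ} (f : V k → V n) : Set where
    field
      affine    : IsAffine f
      injective : Injective _≡_ _≡_ f
      fixed     : Fixes u f

  fixedMono-∘ : ∀ {u k l n} {g : V l → V n} {f : V k → V l} → IsFixedMono u g → IsFixedMono u f → IsFixedMono u (g ∘ f)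
  fixedMono-∘ {g = g} {f} g-fixedMono f-fixedMono = record
    { affine = affine-∘ G.affine F.affine
    ; injective = F.injective ∘ G.injective
    ; fixed = record
      { u≤1+k = Fixes.u≤1+k F.fixed
      ; u≤1+n = Fixes.u≤1+n G.fixed
      ; fixes = λ j j<u → trans (cong g (Fixes.fixes F.fixed j j<u)) (Fixes.fixes G.fixed j j<u)
      }
    }
    where
    module G = IsFixedMono g-fixedMono
    module F = IsFixedMono f-fixedMono

  fixedMono-≗ : ∀ {u k n} {f g : V k → V n} → IsFixedMono u f → (∀ x → g x ≡ f x) → IsFixedMono u g
  fixedMono-≗ {f = f} {g} f-fixedMono g≗f = record
    { affine = affine-≗ affine g≗f
    ; injective = λ {x} {y} gx≡gy → injective (trans (sym (g≗f x)) (trans gx≡gy (g≗f y)))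
    ; fixed = record
      { u≤1+k = Fixes.u≤1+k fixed
      ; u≤1+n = Fixes.u≤1+n fixed
      ; fixes = λ j j<u → trans (g≗f (e j)) (Fixes.fixes fixed j j<u)
      }
    }
    where open IsFixedMono f-fixedMono

  fixes⇒≤ : ∀ {u k n} {f : V k → V n} → Fixes u f → u ∸ 1 ≤ k
  fixes⇒≤ {zero} _ = z≤n
  fixes⇒≤ {suc _} fixed = ℕ.≤-pred (Fixes.u≤1+k fixed)

  pad : ∀ {k d} → k ≤ d → V k → V d
  pad z≤n [] = 0v
  pad (s≤s k≤d) (a ∷ x) = a ∷ pad k≤d x

  pad-refl : ∀ {k} (x : V k) → pad ℕ.≤-refl x ≡ x
  pad-refl [] = refl
  pad-refl (a ∷ x) = cong (a ∷_) (pad-refl x)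

  pad-step : ∀ {k d} (k≤d : k ≤ d) (x : V k) → pad (ℕ.m≤n⇒m≤1+n k≤d) x ≡ pad k≤d x ∷ʳ 0#
  pad-step z≤n [] = sym (0v-∷ʳ _)
    where
    0v-∷ʳ : ∀ d → 0v {d} ∷ʳ 0# ≡ 0v
    0v-∷ʳ zero = refl
    0v-∷ʳ (suc d) = cong (0# ∷_) (0v-∷ʳ d)
  pad-step (s≤s k≤d) (a ∷ x) = cong (a ∷_) (pad-step k≤d x)

  pad-affine : ∀ {k d} (k≤d : k ≤ d) → IsAffine (pad k≤d)
  pad-affine z≤n [] a [] [] = sym (comb-diag 0v a 0v)
  pad-affine (s≤s k≤d) (x ∷ xs) a (y ∷ ys) (z ∷ zs) = cong (_ ∷_) (pad-affine k≤d xs a ys zs)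

  pad-injective : ∀ {k d} (k≤d : k ≤ d) → Injective _≡_ _≡_ (pad k≤d)
  pad-injective z≤n {[]} {[]} _ = refl
  pad-injective (s≤s k≤d) {a ∷ x} {b ∷ y} eq =
    cong₂ _∷_ (Vec.∷-injectiveˡ eq) (pad-injective k≤d (Vec.∷-injectiveʳ eq))

  pad-e : ∀ {k d} (k≤d : k ≤ d) j → j ≤ k → pad k≤d (e j) ≡ e j
  pad-e z≤n zero z≤n = sym e₀≡0v
  pad-e (s≤s k≤d) zero z≤n = cong (0# ∷_) (pad-e k≤d zero z≤n)
  pad-e (s≤s k≤d) (suc j) (s≤s j≤k) = cong (_ ∷_) (pad-e k≤d j j≤k)

  pad-fixedMono : ∀ {u k d} (k≤d : k ≤ d) → u ≤ suc k → IsFixedMono u (pad k≤d)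
  pad-fixedMono k≤d u≤1+k = record
    { affine = pad-affine k≤d
    ; injective = pad-injective k≤d
    ; fixed = record
      { u≤1+k = u≤1+k
      ; u≤1+n = ℕ.≤-trans u≤1+k (s≤s k≤d)
      ; fixes = λ j j<u → pad-e k≤d j (ℕ.≤-pred (ℕ.≤-trans j<u u≤1+k))
      }
    }

  pad-∷ʳ : ∀ {k d} (1+k≤d : suc k ≤ d) (k≤d : k ≤ d) (x : V k) a →
             pad 1+k≤d (x ∷ʳ a) ≡ comb (pad k≤d x) a (e (suc k)) (e 0)
  pad-∷ʳ (s≤s z≤n) z≤n [] a = cong₂ _∷_ coordinate (sym (comb-diag 0v a (e 0)))
    where
    coordinate : a ≡ 0# + a * (1# - 0#)
    coordinate = trans (sym (*-identityˡ a)) (solve 2 (λ a o → o :* a := con 0ℤ :+ a :* (o :- con 0ℤ)) refl a 1#)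
  pad-∷ʳ (s≤s 1+k≤d) (s≤s k≤d) (b ∷ x) a =
    cong₂ _∷_ (solve 2 (λ b a → b := b :+ a :* (con 0ℤ :- con 0ℤ)) refl b a) (pad-∷ʳ 1+k≤d k≤d x a)

  -- The image of pad on V t is the affine span of e₀, …, e_t.
  fixes-pad : ∀ {t k n} {f : V k → V n} → IsAffine f → Fixes (suc t) f → (t≤k : t ≤ k) (t≤n : t ≤ n) (x : V t) →
              f (pad t≤k x) ≡ pad t≤n x
  fixes-pad {zero} {f = f} _ fixed z≤n z≤n [] = begin
    f 0v    ≡⟨ cong f e₀≡0v ⟨
    f (e 0) ≡⟨ Fixes.fixes fixed 0 (s≤s z≤n) ⟩
    e 0     ≡⟨ e₀≡0v ⟩
    0v      ∎
  fixes-pad {suc t} {f = f} f-affine fixed t<k t<n x with initLast x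
  ... | x′ , a , refl = begin
    f (pad t<k (x′ ∷ʳ a))                          ≡⟨ cong f (pad-∷ʳ t<k (ℕ.<⇒≤ t<k) x′ a) ⟩
    f (comb (pad (ℕ.<⇒≤ t<k) x′) a (e (suc t)) (e 0))  ≡⟨ f-affine _ a _ _ ⟩
    comb (f (pad (ℕ.<⇒≤ t<k) x′)) a (f (e (suc t))) (f (e 0))
      ≡⟨ cong₂ (λ s r → comb s a r (f (e 0))) (fixes-pad f-affine fixed′ (ℕ.<⇒≤ t<k) (ℕ.<⇒≤ t<n) x′) (Fixes.fixes fixed (suc t) ℕ.≤-refl) ⟩
    comb (pad (ℕ.<⇒≤ t<n) x′) a (e (suc t)) (f (e 0)) ≡⟨ cong (comb _ a _) (Fixes.fixes fixed 0 (s≤s z≤n)) ⟩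
    comb (pad (ℕ.<⇒≤ t<n) x′) a (e (suc t)) (e 0)     ≡⟨ pad-∷ʳ t<n (ℕ.<⇒≤ t<n) x′ a ⟨
    pad t<n (x′ ∷ʳ a)                              ∎
    where
    fixed′ : Fixes (suc t) f
    fixed′ = record
      { u≤1+k = ℕ.m≤n⇒m≤1+n (ℕ.≤-pred (Fixes.u≤1+k fixed))
      ; u≤1+n = ℕ.m≤n⇒m≤1+n (ℕ.≤-pred (Fixes.u≤1+n fixed))
      ; fixes = λ j j<1+t → Fixes.fixes fixed j (ℕ.m≤n⇒m≤1+n j<1+t)
      }

  fixes-extension : ∀ {u d₀ d n} {β : V d₀ → V n} {ω : V d → V n} → Fixes u β → (d₀≤d : d₀ ≤ d) →
                    (∀ x → ω (pad d₀≤d x) ≡ β x) → Fixes u ω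
  fixes-extension {β = β} {ω} fixed d₀≤d extends = record
    { u≤1+k = ℕ.≤-trans (Fixes.u≤1+k fixed) (s≤s d₀≤d)
    ; u≤1+n = Fixes.u≤1+n fixed
    ; fixes = λ j j<u → begin
        ω (e j)             ≡⟨ cong ω (pad-e d₀≤d j (ℕ.≤-pred (ℕ.≤-trans j<u (Fixes.u≤1+k fixed)))) ⟨
        ω (pad d₀≤d (e j))  ≡⟨ extends (e j) ⟩
        β (e j)             ≡⟨ Fixes.fixes fixed j j<u ⟩
        e j                 ∎
    }

module FiniteDimension (F : FiniteField) where

  open import Defs using (FiniteField; pts; _≟v_)
  open Counting using (vecsOf-complete; vecsOf-unique; vecsOf-length; length-mono-⊆; length-strictMono-⊆)
  open AffineMaps F using (V; Im)
  open import Data.Nat as ℕ using (ℕ; _≤_; _^_)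
  import Data.Nat.Properties as ℕ
  open import Data.List using (List; []; _∷_; length)
  open import Data.List.Properties using (length-map)
  open import Data.List.Membership.Propositional using (_∈_; lose)
  open import Data.List.Membership.Propositional.Properties using (∈-map⁻)
  open import Data.List.Relation.Unary.All using ([]; _∷_)
  open import Data.List.Relation.Unary.AllPairs using ([]; _∷_)
  open import Data.List.Relation.Unary.Any using (satisfied; any?)
  open import Data.List.Relation.Unary.Unique.Propositional using (Unique)
  import Data.List.Relation.Unary.Unique.Propositional.Properties as Unique
  open import Data.Product using (Σ; _,_)
  open import Function using (Injective)
  import Relation.Nullary.Decidable as Dec
  open import Relation.Nullary using (Dec; yes; no; contradiction)
  open import Relation.Unary using (Decidable)
  open import Relation.Binary.PropositionalEquality

  open FiniteField F using (0#; 1#; 0≢1; elems; complete; unique; order)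

  pts-complete : ∀ {n} (x : V n) → x ∈ pts F n
  pts-complete = vecsOf-complete complete

  pts-unique : ∀ n → Unique (pts F n)
  pts-unique = vecsOf-unique unique

  pts-length : ∀ n → length (pts F n) ≡ order ^ n
  pts-length = vecsOf-length elems

  2≤order : 2 ≤ order
  2≤order = length-mono-⊆ ((0≢1 ∷ []) ∷ [] ∷ []) (λ {x} _ → complete x)

  ∃? : ∀ {n} {P : V n → Set} → Decidable P → Dec (Σ (V n) P)
  ∃? {n} P? = Dec.map′ satisfied (λ (x , px) → lose (pts-complete x) px) (any? P? (pts F n))

  im? : ∀ {k n} (f : V k → V n) → Decidable (Im f)
  im? f y = ∃? (λ x → _≟v_ F (f x) y)

  injective⇒≤ : ∀ {k n} (f : V k → V n) → Injective _≡_ _≡_ f → k ≤ n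
  injective⇒≤ {k} {n} f f-inj = ℕ.≮⇒≥ λ n<k → ℕ.<⇒≱ (ℕ.^-monoʳ-< order 2≤order n<k) order^k≤order^n
    where
    order^k≤order^n : order ^ k ≤ order ^ n
    order^k≤order^n = subst₂ _≤_ (trans (length-map f (pts F k)) (pts-length k)) (pts-length n)
                        (length-mono-⊆ (Unique.map⁺ f-inj (pts-unique k)) (λ {y} _ → pts-complete y))

  injective⇒surjective : ∀ {n} (f : V n → V n) → Injective _≡_ _≡_ f → ∀ y → Im f y
  injective⇒surjective {n} f f-inj y with im? f y
  ... | yes y∈im = y∈im
  ... | no y∉im = contradiction (length-strictMono-⊆ (Unique.map⁺ f-inj (pts-unique n)) (λ {z} _ → pts-complete z)
                                  (pts-complete y) (λ y∈ → let (x , _ , y≡fx) = ∈-map⁻ f y∈ in y∉im (x , sym y≡fx)))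
                                (ℕ.<-irrefl (length-map f (pts F n)))

  injective-≤⇒surjective : ∀ {k n} (f : V k → V n) → Injective _≡_ _≡_ f → n ≤ k → ∀ y → Im f y
  injective-≤⇒surjective f f-injective n≤k with ℕ.≤-antisym (injective⇒≤ f f-injective) n≤k
  ... | refl = injective⇒surjective f f-injective

module Charts (F : FiniteField) where

  open import Defs using (FiniteField)
  open FieldArithmetic F
  open AffineMaps F
  open FiniteDimension F
  open import Algebra.Bundles using (CommutativeRing)
  open import Data.Nat as ℕ using (ℕ; zero; suc; _≤_; _∸_; z≤n)
  import Data.Nat.Properties as ℕ
  open import Data.Vec using ([]; _∷ʳ_; init; last; initLast)
  import Data.Vec.Properties as Vec
  open import Data.Product using (Σ; _×_; _,_; proj₁; proj₂)
  open import Data.Unit using (⊤; tt)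
  open import Data.Empty using (⊥-elim)
  open import Function using (Injective; _∘_)
  open import Relation.Nullary using (¬_; yes; no; ¬?; _×-dec_)
  open import Relation.Nullary.Decidable using (decidable-stable)
  open import Relation.Unary using (Decidable)
  open import Relation.Binary.PropositionalEquality
  open ≡-Reasoning

  open FiniteField F using (Carrier; 0#; 1#; _≟_; inverse)
  open CommutativeRing commutativeRing using (_+_; _*_; _-_; +-identityˡ)

  -≢0# : ∀ {a b} → a ≢ b → a - b ≢ 0#
  -≢0# {a} {b} a≢b a-b≡0 = a≢b (begin
    a             ≡⟨ solve 2 (λ a b → a := (a :- b) :+ b) refl a b ⟩
    (a - b) + b   ≡⟨ cong (_+ b) a-b≡0 ⟩
    0# + b        ≡⟨ +-identityˡ b ⟩
    b             ∎)

  ∀-∷ʳ : ∀ {d} {P : V (suc d) → Set} → (∀ x a → P (x ∷ʳ a)) → ∀ v → P v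
  ∀-∷ʳ P-∷ʳ v with initLast v
  ... | x , a , refl = P-∷ʳ x a

  module Extension {d n : ℕ} {ψ : V d → V n} (ψ-affine : IsAffine ψ) (ψ-injective : Injective _≡_ _≡_ ψ)
                   (w : V n) (w∉ψ : ¬ Im ψ w) where

    extend : V (suc d) → V n
    extend v = comb (ψ (init v)) (last v) w (ψ 0v)

    extend-∷ʳ : ∀ x a → extend (x ∷ʳ a) ≡ comb (ψ x) a w (ψ 0v)
    extend-∷ʳ x a = cong₂ (λ y b → comb (ψ y) b w (ψ 0v)) (Vec.init-∷ʳ a x) (Vec.last-∷ʳ a x)

    extend-∷ʳ0# : ∀ x → extend (x ∷ʳ 0#) ≡ ψ x
    extend-∷ʳ0# x = trans (extend-∷ʳ x 0#) (comb-0# (ψ x) w (ψ 0v))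

    extend-affine : IsAffine extend
    extend-affine = ∀-∷ʳ λ x b a → ∀-∷ʳ λ y c → ∀-∷ʳ λ z d → begin
      extend (comb (x ∷ʳ b) a (y ∷ʳ c) (z ∷ʳ d))
        ≡⟨ cong extend (comb-∷ʳ x y z a b c d) ⟩
      extend (comb x a y z ∷ʳ (b + a * (c - d)))
        ≡⟨ extend-∷ʳ (comb x a y z) _ ⟩
      comb (ψ (comb x a y z)) (b + a * (c - d)) w p
        ≡⟨ cong (λ t → comb t (b + a * (c - d)) w p) (ψ-affine x a y z) ⟩
      comb (comb (ψ x) a (ψ y) (ψ z)) (b + a * (c - d)) w p
        ≡⟨ comb-interchange (ψ x) (ψ y) (ψ z) w p a b c d ⟩
      comb (comb (ψ x) b w p) a (comb (ψ y) c w p) (comb (ψ z) d w p)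
        ≡⟨ cong₂ (λ s t → comb s a t _) (extend-∷ʳ x b) (extend-∷ʳ y c) ⟨
      comb (extend (x ∷ʳ b)) a (extend (y ∷ʳ c)) (comb (ψ z) d w p)
        ≡⟨ cong (comb _ a _) (extend-∷ʳ z d) ⟨
      comb (extend (x ∷ʳ b)) a (extend (y ∷ʳ c)) (extend (z ∷ʳ d)) ∎
      where p = ψ 0v

    -- Equal last coordinates reduce to injectivity of ψ; different ones would put w in the image of ψ.
    extend-injective-∷ʳ : ∀ x a y b → extend (x ∷ʳ a) ≡ extend (y ∷ʳ b) → x ∷ʳ a ≡ y ∷ʳ b
    extend-injective-∷ʳ x a y b eq with a ≟ b
    ... | yes refl = cong (_∷ʳ a) (ψ-injective (comb-cancelˡ a w (ψ 0v) eq′))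
      where eq′ = trans (sym (extend-∷ʳ x a)) (trans eq (extend-∷ʳ y a))
    ... | no a≢b = ⊥-elim (w∉ψ (comb 0v c y x , ψ-preimage))
      where
      c : Carrier
      c = proj₁ (inverse (a - b) (-≢0# a≢b))
      ψ-preimage : ψ (comb 0v c y x) ≡ w
      ψ-preimage = trans (ψ-affine 0v c y x) (sym (comb-solve (proj₂ (inverse (a - b) (-≢0# a≢b)))
                     (trans (sym (extend-∷ʳ x a)) (trans eq (extend-∷ʳ y b)))))

    extend-injective : Injective _≡_ _≡_ extend
    extend-injective {v} {v′} = ∀-∷ʳ {P = λ v → extend v ≡ extend v′ → v ≡ v′}
      (λ x a → ∀-∷ʳ {P = λ v′ → extend (x ∷ʳ a) ≡ extend v′ → x ∷ʳ a ≡ v′} (extend-injective-∷ʳ x a) v′) v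

  record Chart {n d₀ : ℕ} (W : V n → Set) (β : V d₀ → V n) (d : ℕ) : Set where
    field
      chart     : V d → V n
      affine    : IsAffine chart
      injective : Injective _≡_ _≡_ chart
      inside    : ∀ x → W (chart x)
      d₀≤d      : d₀ ≤ d
      extends   : ∀ x → chart (pad d₀≤d x) ≡ β x

  CompleteChart : ∀ {n d₀} (W : V n → Set) (β : V d₀ → V n) → Set
  CompleteChart W β = Σ ℕ λ d → Σ (Chart W β d) λ C → ∀ y → W y → Im (Chart.chart C) y

  AffinelyClosed : ∀ {n} → (V n → Set) → Set
  AffinelyClosed W = ∀ x a y z → W x → W y → W z → W (comb x a y z)

  module _ {n d₀ : ℕ} {W : V n → Set} (W? : Decidable W) (W-closed : AffinelyClosed W) {β : V d₀ → V n} where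

    extendChart : ∀ {d} (C : Chart W β d) (w : V n) → W w → ¬ Im (Chart.chart C) w → Chart W β (suc d)
    extendChart C w Ww w∉C = record
      { chart = extend
      ; affine = extend-affine
      ; injective = extend-injective
      ; inside = ∀-∷ʳ λ x a → subst W (sym (extend-∷ʳ x a)) (W-closed _ a _ _ (Chart.inside C x) Ww (Chart.inside C 0v))
      ; d₀≤d = ℕ.m≤n⇒m≤1+n (Chart.d₀≤d C)
      ; extends = λ x → trans (cong extend (pad-step (Chart.d₀≤d C) x)) (trans (extend-∷ʳ0# _) (Chart.extends C x))
      }
      where
      open Extension (Chart.affine C) (Chart.injective C) w w∉C

    -- Each extension raises the dimension of an injective map into V n, so fuel n + 1 suffices.
    completeChart : IsAffine β → Injective _≡_ _≡_ β → (∀ x → W (β x)) → CompleteChart W β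
    completeChart β-affine β-injective β-inside = grow (suc n) (ℕ.m≤m+n (suc n) d₀) initial
      where
      initial : Chart W β d₀
      initial = record
        { chart = β ; affine = β-affine ; injective = β-injective ; inside = β-inside
        ; d₀≤d = ℕ.≤-refl ; extends = λ x → cong β (pad-refl x) }
      grow : ∀ fuel {d} → suc n ≤ fuel ℕ.+ d → Chart W β d → CompleteChart W β
      grow zero {d} n<d C = ⊥-elim (ℕ.<⇒≱ n<d (injective⇒≤ _ (Chart.injective C)))
      grow (suc fuel) {d} n<fuel+d C with ∃? (λ y → W? y ×-dec ¬? (im? (Chart.chart C) y))
      ... | yes (w , Ww , w∉C) = grow fuel (subst (suc n ≤_) (sym (ℕ.+-suc fuel d)) n<fuel+d) (extendChart C w Ww w∉C)
      ... | no nothing-missing = d , C , λ y Wy → decidable-stable (im? (Chart.chart C) y) (λ y∉C → nothing-missing (y , Wy , y∉C))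

  record Automorphism (u n : ℕ) : Set where
    field
      to             : V n → V n
      from           : V n → V n
      to-fixedMono   : IsFixedMono u to
      from-fixedMono : IsFixedMono u from
      to∘from        : ∀ y → to (from y) ≡ y
      from∘to        : ∀ x → from (to x) ≡ x

  automorphism : ∀ {u n} {f : V n → V n} → IsFixedMono u f → Automorphism u n
  automorphism {u} {n} {f} f-fixedMono = record
    { to = f
    ; from = from
    ; to-fixedMono = f-fixedMono
    ; from-fixedMono = record
      { affine = λ x a y z → injective (begin
          f (from (comb x a y z))                 ≡⟨ to∘from _ ⟩
          comb x a y z                            ≡⟨ cong₂ (λ s t → comb s a t z) (to∘from x) (to∘from y) ⟨
          comb (f (from x)) a (f (from y)) z      ≡⟨ cong (comb _ a _) (to∘from z) ⟨
          comb (f (from x)) a (f (from y)) (f (from z)) ≡⟨ affine (from x) a (from y) (from z) ⟨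
          f (comb (from x) a (from y) (from z))   ∎)
      ; injective = λ {x} {y} eq → trans (sym (to∘from x)) (trans (cong f eq) (to∘from y))
      ; fixed = record
        { u≤1+k = u≤1+k ; u≤1+n = u≤1+n
        ; fixes = λ j j<u → injective (trans (to∘from (e j)) (sym (fixes j j<u))) }
      }
    ; to∘from = to∘from
    ; from∘to = λ x → injective (to∘from (f x))
    }
    where
    open IsFixedMono f-fixedMono
    open Fixes fixed
    from : V n → V n
    from y = proj₁ (injective⇒surjective f injective y)
    to∘from : ∀ y → f (from y) ≡ y
    to∘from y = proj₂ (injective⇒surjective f injective y)

  automorphism-∘ : ∀ {u n} → Automorphism u n → Automorphism u n → Automorphism u n
  automorphism-∘ g h = record
    { to = G.to ∘ H.to
    ; from = H.from ∘ G.from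
    ; to-fixedMono = fixedMono-∘ G.to-fixedMono H.to-fixedMono
    ; from-fixedMono = fixedMono-∘ H.from-fixedMono G.from-fixedMono
    ; to∘from = λ y → trans (cong G.to (H.to∘from (G.from y))) (G.to∘from y)
    ; from∘to = λ x → trans (cong H.from (G.from∘to (H.to x))) (H.from∘to x)
    }
    where
    module G = Automorphism g
    module H = Automorphism h

  automorphism-inverse : ∀ {u n} → Automorphism u n → Automorphism u n
  automorphism-inverse g = record
    { to = from ; from = to ; to-fixedMono = from-fixedMono ; from-fixedMono = to-fixedMono
    ; to∘from = from∘to ; from∘to = to∘from }
    where open Automorphism g

  -- Complete ψ to an affine bijection of V n by adjoining directions until V n is exhausted.
  extendToAutomorphism : ∀ {u d n} {ψ : V d → V n} → IsFixedMono u ψ →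
                         Σ (Automorphism u n) λ Ψ → Σ (d ≤ n) λ d≤n → ∀ x → Automorphism.to Ψ (pad d≤n x) ≡ ψ x
  extendToAutomorphism {u} {d} {n} {ψ} ψ-fixedMono with completeChart {W = λ _ → ⊤} (λ _ → yes tt) (λ _ _ _ _ _ _ _ → tt)
                                                           (IsFixedMono.affine ψ-fixedMono) (IsFixedMono.injective ψ-fixedMono) (λ _ → tt)
  ... | d′ , C , onto with ℕ.≤-antisym (injective⇒≤ (Chart.chart C) (Chart.injective C)) (injective⇒≤ section section-injective)
    where
    section : V n → V d′
    section y = proj₁ (onto y tt)
    section-injective : Injective _≡_ _≡_ section
    section-injective {y} {y′} eq = trans (sym (proj₂ (onto y tt))) (trans (cong (Chart.chart C) eq) (proj₂ (onto y′ tt)))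
  ... | refl = automorphism Ψ-fixedMono , Chart.d₀≤d C , Chart.extends C
    where
    Ψ-fixedMono : IsFixedMono u (Chart.chart C)
    Ψ-fixedMono = record
      { affine = Chart.affine C
      ; injective = Chart.injective C
      ; fixed = fixes-extension (IsFixedMono.fixed ψ-fixedMono) (Chart.d₀≤d C) (Chart.extends C)
      }

  transport : ∀ {u D n} {ψ₁ ψ₂ : V D → V n} → IsFixedMono u ψ₁ → IsFixedMono u ψ₂ →
              Σ (Automorphism u n) λ g → ∀ x → Automorphism.to g (ψ₁ x) ≡ ψ₂ x
  transport {ψ₁ = ψ₁} {ψ₂} ψ₁-fixedMono ψ₂-fixedMono
    with extendToAutomorphism ψ₁-fixedMono | extendToAutomorphism ψ₂-fixedMono
  ... | Ψ₁ , D≤n , Ψ₁-extends | Ψ₂ , D≤n′ , Ψ₂-extends =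
    automorphism-∘ Ψ₂ (automorphism-inverse Ψ₁) , λ x → begin
      Ψ₂.to (Ψ₁.from (ψ₁ x))           ≡⟨ cong (Ψ₂.to ∘ Ψ₁.from) (Ψ₁-extends x) ⟨
      Ψ₂.to (Ψ₁.from (Ψ₁.to (pad D≤n x))) ≡⟨ cong Ψ₂.to (Ψ₁.from∘to (pad D≤n x)) ⟩
      Ψ₂.to (pad D≤n x)                ≡⟨ cong (λ p → Ψ₂.to (pad p x)) (ℕ.≤-irrelevant D≤n D≤n′) ⟩
      Ψ₂.to (pad D≤n′ x)               ≡⟨ Ψ₂-extends x ⟩
      ψ₂ x                             ∎
    where
    module Ψ₁ = Automorphism Ψ₁
    module Ψ₂ = Automorphism Ψ₂

  preimage-closed : ∀ {k n d} {φ : V k → V n} {ψ : V d → V n} → IsAffine φ → IsAffine ψ → AffinelyClosed (λ y → Im ψ (φ y))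
  preimage-closed {φ = φ} {ψ} φ-affine ψ-affine x a y z (x′ , ψx′≡φx) (y′ , ψy′≡φy) (z′ , ψz′≡φz) = comb x′ a y′ z′ , (begin
    ψ (comb x′ a y′ z′)             ≡⟨ ψ-affine x′ a y′ z′ ⟩
    comb (ψ x′) a (ψ y′) (ψ z′)     ≡⟨ cong₂ (λ s t → comb s a t (ψ z′)) ψx′≡φx ψy′≡φy ⟩
    comb (φ x) a (φ y) (ψ z′)       ≡⟨ cong (comb (φ x) a (φ y)) ψz′≡φz ⟩
    comb (φ x) a (φ y) (φ z)        ≡⟨ φ-affine x a y z ⟨
    φ (comb x a y z)                ∎)

  -- Starting point of a chart of φ⁻¹(Im ψ): the span of the fixed points, or any point when there are none.
  fixedBase : ∀ {u k n d} {φ : V k → V n} {ψ : V d → V n} → IsFixedMono u φ → IsFixedMono u ψ →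
              (u ≡ 0 → Σ (V k) λ y → Im ψ (φ y)) → Σ (V (u ∸ 1) → V k) λ β → IsFixedMono u β × (∀ x → Im ψ (φ (β x)))
  fixedBase {zero} _ _ point with point refl
  ... | y , y∈ = (λ _ → y) , const-fixedMono , λ _ → y∈
    where
    const-fixedMono : IsFixedMono 0 (λ (_ : V 0) → y)
    const-fixedMono = record
      { affine = λ _ a _ _ → sym (comb-diag y a y)
      ; injective = λ { {[]} {[]} _ → refl }
      ; fixed = record { u≤1+k = z≤n ; u≤1+n = z≤n ; fixes = λ _ () }
      }
  fixedBase {suc t} {k} {n} {d} {φ} {ψ} φ-fixedMono ψ-fixedMono _ =
    pad t≤k , pad-fixedMono t≤k ℕ.≤-refl ,
    λ x → pad t≤d x , trans (fixes-pad ψ-affine ψ-fixed t≤d t≤n x) (sym (fixes-pad φ-affine φ-fixed t≤k t≤n x))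
    where
    open IsFixedMono φ-fixedMono using () renaming (affine to φ-affine; fixed to φ-fixed)
    open IsFixedMono ψ-fixedMono using () renaming (affine to ψ-affine; fixed to ψ-fixed)
    t≤k : t ≤ k
    t≤k = ℕ.≤-pred (Fixes.u≤1+k φ-fixed)
    t≤n : t ≤ n
    t≤n = ℕ.≤-pred (Fixes.u≤1+n φ-fixed)
    t≤d : t ≤ d
    t≤d = ℕ.≤-pred (Fixes.u≤1+k ψ-fixed)

  -- A fixed parametrisation of φ⁻¹(Im ψ); injectivity of φ bounds its dimension by that of ψ.
  record PreimageChart (u : ℕ) {k n d : ℕ} (φ : V k → V n) (ψ : V d → V n) : Set where
    field
      dim       : ℕ
      chart     : V dim → V k
      fixedMono : IsFixedMono u chart
      dim≤d     : dim ≤ d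
      inside    : ∀ x → Im ψ (φ (chart x))
      covers    : ∀ y → Im ψ (φ y) → Im chart y

  preimageChart : ∀ {u k n d} {φ : V k → V n} {ψ : V d → V n} → IsFixedMono u φ → IsFixedMono u ψ →
                  (u ≡ 0 → Σ (V k) λ y → Im ψ (φ y)) → PreimageChart u φ ψ
  preimageChart {u} {k} {n} {d} {φ} {ψ} φ-fixedMono ψ-fixedMono point
    with fixedBase φ-fixedMono ψ-fixedMono point
  ... | β , β-fixedMono , β-inside
    with completeChart (λ y → im? ψ (φ y)) (preimage-closed (IsFixedMono.affine φ-fixedMono) (IsFixedMono.affine ψ-fixedMono))
                       (IsFixedMono.affine β-fixedMono) (IsFixedMono.injective β-fixedMono) β-inside
  ... | dim , C , covers = record
    { dim = dim
    ; chart = chart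
    ; fixedMono = record { affine = affine ; injective = injective ; fixed = fixes-extension (IsFixedMono.fixed β-fixedMono) d₀≤d extends }
    ; dim≤d = injective⇒≤ lift lift-injective
    ; inside = inside
    ; covers = covers
    }
    where
    open Chart C
    lift : V dim → V d
    lift x = proj₁ (inside x)
    lift-injective : Injective _≡_ _≡_ lift
    lift-injective {x} {y} eq = injective (IsFixedMono.injective φ-fixedMono
      (trans (sym (proj₂ (inside x))) (trans (cong ψ eq) (proj₂ (inside y)))))

module AffineMatrices (F : FiniteField) where

  open import Defs
  open FieldArithmetic F
  open AffineMaps F
  open FiniteDimension F
  open Counting using (vecsOf-complete)
  open import Algebra.Bundles using (CommutativeRing)
  open import Data.Nat using (zero; suc)
  open import Data.Integer using (0ℤ)
  open import Data.Vec using (Vec; []; _∷_; replicate; zipWith)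
  open import Data.List.Membership.Propositional using (_∈_; lose)
  open import Data.List.Membership.Propositional.Properties using (∈-cartesianProduct⁺; ∈-upTo⁺; ∈-upTo⁻)
  open import Data.List.Relation.Unary.All as All using (All)
  open import Data.List.Relation.Unary.Any using (Any; satisfied)
  open import Data.Product using (Σ; _×_; _,_; proj₁; proj₂)
  open import Function using (_∘_)
  import Function as Fun
  open import Relation.Binary.PropositionalEquality
  open ≡-Reasoning

  open FiniteField F using (Carrier; 0#; 1#)
  open CommutativeRing commutativeRing using (_+_; _*_; _-_; +-identityˡ; *-identityˡ)

  dot-comb : ∀ {k} (r x : V k) a y z → dot F r (comb x a y z) ≡ dot F r x + a * (dot F r y - dot F r z)
  dot-comb [] [] a [] [] = solve 1 (λ a → con 0ℤ := con 0ℤ :+ a :* (con 0ℤ :- con 0ℤ)) refl a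
  dot-comb (r ∷ rs) (x ∷ xs) a (y ∷ ys) (z ∷ zs) = begin
    r * (x + a * (y - z)) + dot F rs (comb xs a ys zs)
      ≡⟨ cong (r * (x + a * (y - z)) +_) (dot-comb rs xs a ys zs) ⟩
    r * (x + a * (y - z)) + (Dx + a * (Dy - Dz))
      ≡⟨ solve 8 (λ r x a y z Dx Dy Dz → r :* (x :+ a :* (y :- z)) :+ (Dx :+ a :* (Dy :- Dz))
                                          := (r :* x :+ Dx) :+ a :* ((r :* y :+ Dy) :- (r :* z :+ Dz)))
                 refl r x a y z Dx Dy Dz ⟩
    (r * x + Dx) + a * ((r * y + Dy) - (r * z + Dz)) ∎
    where
    Dx Dy Dz : Carrier
    Dx = dot F rs xs
    Dy = dot F rs ys
    Dz = dot F rs zs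

  apply-affine : ∀ {k n} (φ : Aff F k n) → IsAffine (apply F φ)
  apply-affine ([] , []) x a y z = refl
  apply-affine (r ∷ M , c ∷ b) x a y z = cong₂ _∷_ coordinate (apply-affine (M , b) x a y z)
    where
    coordinate : dot F r (comb x a y z) + c ≡ (dot F r x + c) + a * ((dot F r y + c) - (dot F r z + c))
    coordinate = trans (cong (_+ c) (dot-comb r x a y z))
      (solve 5 (λ a Dx Dy Dz c → (Dx :+ a :* (Dy :- Dz)) :+ c := (Dx :+ c) :+ a :* ((Dy :+ c) :- (Dz :+ c)))
         refl a (dot F r x) (dot F r y) (dot F r z) c)

  apply-constant : ∀ {n} (b : V n) → apply F (replicate n [] , b) [] ≡ b
  apply-constant [] = refl
  apply-constant (c ∷ b) = cong₂ _∷_ (+-identityˡ c) (apply-constant b)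

  apply-∷ : ∀ {k n} (M : Vec (V k) n) (b y z : V n) a x →
            apply F (zipWith _∷_ (zipWith _-_ y z) M , b) (a ∷ x) ≡ comb (apply F (M , b) x) a y z
  apply-∷ [] [] [] [] a x = refl
  apply-∷ (r ∷ M) (c ∷ b) (y ∷ ys) (z ∷ zs) a x = cong₂ _∷_
    (solve 5 (λ y z a D c → (y :- z) :* a :+ D :+ c := (D :+ c) :+ a :* (y :- z)) refl y z a (dot F r x) c)
    (apply-∷ M b ys zs a x)

  -- The first column is f(e₁) - f(0); the others come from the restriction of f to the hyperplane x₁ = 0.
  toAff : ∀ {k n} (f : V k → V n) → IsAffine f → Σ (Aff F k n) λ φ → ∀ x → apply F φ x ≡ f x
  toAff {zero} {n} f _ = (replicate n [] , f []) , λ { [] → apply-constant (f []) }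
  toAff {suc k} {n} f f-affine = (zipWith _∷_ (zipWith _-_ (f (1# ∷ 0v)) (f 0v)) (proj₁ (proj₁ tail)) , proj₂ (proj₁ tail)) , λ
    { (a ∷ x) → begin
        apply F _ (a ∷ x)                                  ≡⟨ apply-∷ _ _ (f (1# ∷ 0v)) (f 0v) a x ⟩
        comb (apply F (proj₁ tail) x) a (f (1# ∷ 0v)) (f 0v) ≡⟨ cong (λ t → comb t a _ _) (proj₂ tail x) ⟩
        comb (f (0# ∷ x)) a (f (1# ∷ 0v)) (f 0v)           ≡⟨ f-affine (0# ∷ x) a (1# ∷ 0v) 0v ⟨
        f (comb (0# ∷ x) a (1# ∷ 0v) 0v)                    ≡⟨ cong f (cong₂ _∷_ (first a) (comb-diag x a 0v)) ⟩
        f (a ∷ x)                                          ∎ }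
    where
    first : ∀ a → 0# + a * (1# - 0#) ≡ a
    first a = trans (solve 2 (λ a o → con 0ℤ :+ a :* (o :- con 0ℤ) := o :* a) refl a 1#) (*-identityˡ a)
    on-hyperplane : ∀ x a y z → 0# ∷ comb x a y z ≡ comb (0# ∷ x) a (0# ∷ y) (0# ∷ z)
    on-hyperplane x a y z = cong (_∷ comb x a y z) (solve 1 (λ a → con 0ℤ := con 0ℤ :+ a :* (con 0ℤ :- con 0ℤ)) refl a)
    tail : Σ (Aff F k n) λ φ → ∀ x → apply F φ x ≡ f (0# ∷ x)
    tail = toAff (f ∘ (0# ∷_)) λ x a y z → trans (cong f (on-hyperplane x a y z)) (f-affine _ a _ _)

  affs-complete : ∀ {k n} (φ : Aff F k n) → φ ∈ affs F k n
  affs-complete (M , b) = ∈-cartesianProduct⁺ (vecsOf-complete pts-complete M) (pts-complete b)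

  Any-affs⇒ : ∀ {k n} {P : Aff F k n → Set} → Any P (affs F k n) → Σ (Aff F k n) P
  Any-affs⇒ = satisfied

  Any-affs⇐ : ∀ {k n} {P : Aff F k n → Set} (φ : Aff F k n) → P φ → Any P (affs F k n)
  Any-affs⇐ φ = lose (affs-complete φ)

  Any-pts⇒Im : ∀ {k n} (f : V k → V n) {y} → Any (λ x → f x ≡ y) (pts F k) → Im f y
  Any-pts⇒Im f = satisfied

  Im⇒Any-pts : ∀ {k n} (f : V k → V n) {y} → Im f y → Any (λ x → f x ≡ y) (pts F k)
  Im⇒Any-pts f (x , fx≡y) = lose (pts-complete x) fx≡y

  Injective⇒ : ∀ {k n} (φ : Aff F k n) → Injective F φ → Fun.Injective _≡_ _≡_ (apply F φ)
  Injective⇒ φ φ-injective {x} {y} = All.lookup (All.lookup φ-injective (pts-complete x)) (pts-complete y)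

  Injective⇐ : ∀ {k n} (φ : Aff F k n) → Fun.Injective _≡_ _≡_ (apply F φ) → Injective F φ
  Injective⇐ φ φ-injective = All.tabulate λ _ → All.tabulate λ _ → φ-injective

  Surjective⇐ : ∀ {k n} (φ : Aff F k n) → (∀ y → Im (apply F φ) y) → Surjective F φ
  Surjective⇐ φ onto = All.tabulate λ {y} _ → Im⇒Any-pts (apply F φ) (onto y)

  Fixed⇔Fixes : ∀ {u k n} (φ : Aff F k n) → (Fixed F u φ → Fixes u (apply F φ)) × (Fixes u (apply F φ) → Fixed F u φ)
  Fixed⇔Fixes φ =
    (λ (u≤1+k , u≤1+n , fixes) → record { u≤1+k = u≤1+k ; u≤1+n = u≤1+n ; fixes = λ j j<u → All.lookup fixes (∈-upTo⁺ j<u) }) ,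
    (λ fixed → Fixes.u≤1+k fixed , Fixes.u≤1+n fixed , All.tabulate λ j∈ → Fixes.fixes fixed _ (∈-upTo⁻ j∈))

  Aff⇒fixedMono : ∀ {u k n} (φ : Aff F k n) → Fixed F u φ → Injective F φ → IsFixedMono u (apply F φ)
  Aff⇒fixedMono φ φ-fixed φ-injective = record
    { affine = apply-affine φ ; injective = Injective⇒ φ φ-injective ; fixed = proj₁ (Fixed⇔Fixes φ) φ-fixed }

  fixedMono⇒Aff : ∀ {u k n} {f : V k → V n} → IsFixedMono u f →
                  Σ (Aff F k n) λ φ → (∀ x → apply F φ x ≡ f x) × Fixed F u φ × Injective F φ
  fixedMono⇒Aff {f = f} f-fixedMono with toAff f (IsFixedMono.affine f-fixedMono)
  ... | φ , φ≗f = φ , φ≗f , proj₂ (Fixed⇔Fixes φ) (IsFixedMono.fixed φ-fixedMono) , Injective⇐ φ (IsFixedMono.injective φ-fixedMono)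
    where
    φ-fixedMono : IsFixedMono _ (apply F φ)
    φ-fixedMono = fixedMono-≗ f-fixedMono φ≗f

module Subspaces (F : FiniteField) where

  open import Defs using (FiniteField; Contained; DimIs; tplus1; apply)
  open Counting using (All-toList-map⁺; All-toList-map⁻)
  open AffineMaps F
  open FiniteDimension F
  open Charts F
  open AffineMatrices F
  open import Data.Nat as ℕ using (ℕ; _≤_; _<_; _∸_)
  import Data.Nat.Properties as ℕ
  open import Data.Vec as Vec using (Vec; []; _∷_; toList)
  open import Data.List.Membership.Propositional using (_∈_)
  open import Data.List.Membership.Propositional.Properties using (∈-upTo⁺; ∈-upTo⁻)
  open import Data.List.Relation.Unary.All as All using (All; []; _∷_)
  open import Data.Product using (Σ; _×_; _,_; proj₁; proj₂)
  open import Data.Sum using (inj₁; inj₂)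
  open import Function using (_∘_)
  open import Relation.Nullary using (¬_; contradiction)
  open import Relation.Binary.PropositionalEquality

  InSubspace : ∀ {m n} → ℕ → ℕ → Vec (V n) m → Set
  InSubspace {n = n} u d s = Σ (V d → V n) λ ψ → IsFixedMono u ψ × All (Im ψ) (toList s)

  record HasDim {m n : ℕ} (u : ℕ) (s : Vec (V n) m) (D : ℕ) : Set where
    field
      inSubspace : InSubspace u D s
      minimal    : ∀ d → d < D → ¬ InSubspace u d s

  inSubspace⇒≤ : ∀ {m n u d} {s : Vec (V n) m} → InSubspace u d s → u ∸ 1 ≤ d
  inSubspace⇒≤ (_ , ψ-fixedMono , _) = fixes⇒≤ (IsFixedMono.fixed ψ-fixedMono)

  Contained⇒InSubspace : ∀ {m n} t d (s : Vec (V n) m) → Contained F t d s → InSubspace (tplus1 t) d s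
  Contained⇒InSubspace t d s contained with Any-affs⇒ contained
  ... | φ , φ-fixed , φ-injective , s⊆φ = apply F φ , Aff⇒fixedMono φ φ-fixed φ-injective , All.map (Any-pts⇒Im (apply F φ)) s⊆φ

  InSubspace⇒Contained : ∀ {m n} t d (s : Vec (V n) m) → InSubspace (tplus1 t) d s → Contained F t d s
  InSubspace⇒Contained t d s (ψ , ψ-fixedMono , s⊆ψ) with fixedMono⇒Aff ψ-fixedMono
  ... | φ , φ≗ψ , φ-fixed , φ-injective =
    Any-affs⇐ φ (φ-fixed , φ-injective , All.map (λ (x , ψx≡y) → Im⇒Any-pts (apply F φ) (x , trans (φ≗ψ x) ψx≡y)) s⊆ψ)

  DimIs⇒HasDim : ∀ {m n} t (s : Vec (V n) m) D → DimIs F t s D → HasDim (tplus1 t) s D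
  DimIs⇒HasDim t s D (_ , contained , minimal) = record
    { inSubspace = Contained⇒InSubspace t D s contained
    ; minimal = λ d d<D ∈d → All.lookup minimal (∈-upTo⁺ d<D) (inSubspace⇒≤ ∈d) (InSubspace⇒Contained t d s ∈d)
    }

  HasDim⇒DimIs : ∀ {m n} t (s : Vec (V n) m) D → HasDim (tplus1 t) s D → DimIs F t s D
  HasDim⇒DimIs t s D hasDim =
    inSubspace⇒≤ inSubspace , InSubspace⇒Contained t D s inSubspace ,
    All.tabulate λ d∈ _ ∈d → minimal _ (∈-upTo⁻ d∈) (Contained⇒InSubspace t _ s ∈d)
    where open HasDim hasDim

  module _ {u k n : ℕ} {φ : V k → V n} (φ-fixedMono : IsFixedMono u φ) where

    inSubspace-map : ∀ {m d} {s : Vec (V k) m} → InSubspace u d s → InSubspace u d (Vec.map φ s)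
    inSubspace-map (ψ , ψ-fixedMono , s⊆ψ) =
      φ ∘ ψ , fixedMono-∘ φ-fixedMono ψ-fixedMono , All-toList-map⁺ φ (All.map (λ (x , ψx≡y) → x , cong φ ψx≡y) s⊆ψ)

    inSubspace-unmap : ∀ {m d} {s : Vec (V k) m} → InSubspace u d (Vec.map φ s) → Σ ℕ λ d′ → d′ ≤ d × InSubspace u d′ s
    inSubspace-unmap {s = []} (ψ , ψ-fixedMono , _) =
      u ∸ 1 , fixes⇒≤ (IsFixedMono.fixed ψ-fixedMono) , pad u∸1≤k , pad-fixedMono u∸1≤k (ℕ.m≤n+m∸n u 1) , []
      where u∸1≤k = fixes⇒≤ (IsFixedMono.fixed φ-fixedMono)
    inSubspace-unmap {s = s₀ ∷ s} (ψ , ψ-fixedMono , φs⊆ψ) =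
      dim , dim≤d , chart , fixedMono , All.map (covers _) (All-toList-map⁻ φ {s = s₀ ∷ s} φs⊆ψ)
      where
      open PreimageChart (preimageChart φ-fixedMono ψ-fixedMono λ _ → s₀ , All.head φs⊆ψ)

    hasDim-map : ∀ {m D} {s : Vec (V k) m} → HasDim u s D → HasDim u (Vec.map φ s) D
    hasDim-map hasDim = record
      { inSubspace = inSubspace-map (HasDim.inSubspace hasDim)
      ; minimal = λ d d<D ∈d → let (d′ , d′≤d , ∈d′) = inSubspace-unmap ∈d in
                                HasDim.minimal hasDim d′ (ℕ.≤-<-trans d′≤d d<D) ∈d′
      }

    hasDim-unmap : ∀ {m D} {s : Vec (V k) m} → HasDim u (Vec.map φ s) D → HasDim u s D
    hasDim-unmap {D = D} hasDim with inSubspace-unmap (HasDim.inSubspace hasDim)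
    ... | d′ , d′≤D , ∈d′ with ℕ.m≤n⇒m<n∨m≡n d′≤D
    ...   | inj₁ d′<D = contradiction (inSubspace-map ∈d′) (HasDim.minimal hasDim d′ d′<D)
    ...   | inj₂ refl = record
      { inSubspace = ∈d′
      ; minimal = λ d d<D ∈d → HasDim.minimal hasDim d d<D (inSubspace-map ∈d)
      }

  -- ψ⁻¹(Im φ) is a fixed subspace of V D through (the parameters of) s, hence all of V D by minimality.
  minimal-⊆ : ∀ {u m n D k} {s : Vec (V n) m} {ψ : V D → V n} → IsFixedMono u ψ → All (Im ψ) (toList s) →
              (∀ d → d < D → ¬ InSubspace u d s) → {s₀ : V n} → s₀ ∈ toList s →
              {φ : V k → V n} → IsFixedMono u φ → All (Im φ) (toList s) → ∀ x → Im φ (ψ x)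
  minimal-⊆ {D = D} {s = s} {ψ} ψ-fixedMono s⊆ψ minimal s₀∈s {φ} φ-fixedMono s⊆φ x =
    subst (Im φ ∘ ψ) (proj₂ x∈chart) (inside (proj₁ x∈chart))
    where
    point : Σ (V D) λ y → Im φ (ψ y)
    point = let (x₀ , ψx₀≡s₀) = All.lookup s⊆ψ s₀∈s in x₀ , subst (Im φ) (sym ψx₀≡s₀) (All.lookup s⊆φ s₀∈s)
    open PreimageChart (preimageChart ψ-fixedMono φ-fixedMono λ _ → point)
    s⊆ψ∘chart : InSubspace _ dim s
    s⊆ψ∘chart = ψ ∘ chart , fixedMono-∘ ψ-fixedMono fixedMono , All.zipWith
      (λ ((y , ψy≡sⱼ) , φ∋sⱼ) → let (z , chartz≡y) = covers y (subst (Im φ) (sym ψy≡sⱼ) φ∋sⱼ) in z , trans (cong ψ chartz≡y) ψy≡sⱼ)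
      (s⊆ψ , s⊆φ)
    x∈chart : Im chart x
    x∈chart = injective-≤⇒surjective chart (IsFixedMono.injective fixedMono) (ℕ.≮⇒≥ λ dim<D → minimal dim dim<D s⊆ψ∘chart) x

module Solutions (F : FiniteField) where

  open import Defs hiding (Injective)
  open FieldArithmetic F
  open AffineMaps F
  open import Algebra.Bundles using (CommutativeRing)
  open import Data.Nat as ℕ using (ℕ)
  import Data.Nat.Properties as ℕ
  open import Data.Integer as ℤ using (ℤ; 0ℤ)
  open import Data.Vec as Vec using (Vec; []; _∷_; replicate)
  import Data.Vec.Properties as Vecₚ
  open import Data.List.Relation.Unary.All as All using (All; []; _∷_)
  open import Data.Product using (_,_)
  open import Data.Sum using (inj₁; inj₂)
  open import Function using (Injective)
  open import Relation.Binary.PropositionalEquality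
  open ≡-Reasoning

  open FiniteField F using (Carrier; 0#)
  open CommutativeRing commutativeRing using (_+_; _*_; _-_; +-assoc; +-identityˡ; +-identityʳ; zeroʳ)
  open import Algebra.Properties.Ring (CommutativeRing.ring commutativeRing) using (+-cancelʳ)

  vadd-identityˡ : ∀ {n} (x : V n) → vadd F 0v x ≡ x
  vadd-identityˡ = Vecₚ.zipWith-identityˡ +-identityˡ

  vadd-identityʳ : ∀ {n} (x : V n) → vadd F x 0v ≡ x
  vadd-identityʳ = Vecₚ.zipWith-identityʳ +-identityʳ

  vadd-cancelʳ : ∀ {n} {x y : V n} (p : V n) → vadd F x p ≡ vadd F y p → x ≡ y
  vadd-cancelʳ {x = []} {[]} [] _ = refl
  vadd-cancelʳ {x = a ∷ x} {b ∷ y} (c ∷ p) eq = cong₂ _∷_ (+-cancelʳ c a b (Vecₚ.∷-injectiveˡ eq)) (vadd-cancelʳ p (Vecₚ.∷-injectiveʳ eq))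

  rowApply-zero : ∀ {m n} (row : Vec ℤ m) → rowApply F row (replicate m (0v {n})) ≡ 0v
  rowApply-zero [] = refl
  rowApply-zero (c ∷ row) = begin
    vadd F (scale F (embℤ F c) 0v) (rowApply F row (replicate _ 0v)) ≡⟨ cong (vadd F _) (rowApply-zero row) ⟩
    vadd F (scale F (embℤ F c) 0v) 0v                               ≡⟨ vadd-identityʳ _ ⟩
    scale F (embℤ F c) 0v                                           ≡⟨ Vecₚ.map-replicate (embℤ F c *_) 0# _ ⟩
    replicate _ (embℤ F c * 0#)                                      ≡⟨ cong (replicate _) (zeroʳ (embℤ F c)) ⟩
    0v                                                              ∎

  -- Σᵢ cᵢ φ(sᵢ) + φ(0) = φ(Σᵢ cᵢ sᵢ) + Σᵢ cᵢ φ(0), with both sides moved so that no subtraction occurs.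
  rowApply-affine : ∀ {k n m} {φ : V k → V n} → IsAffine φ → (row : Vec ℤ m) (s : Vec (V k) m) →
                    vadd F (rowApply F row (Vec.map φ s)) (φ 0v) ≡ vadd F (φ (rowApply F row s)) (rowApply F row (replicate m (φ 0v)))
  rowApply-affine {φ = φ} _ [] [] = trans (vadd-identityˡ (φ 0v)) (sym (vadd-identityʳ (φ 0v)))
  rowApply-affine {φ = φ} φ-affine (c ∷ row) (x ∷ s) = begin
    vadd F (vadd F (scale F a (φ x)) L) p            ≡⟨ Vecₚ.zipWith-assoc +-assoc (scale F a (φ x)) L p ⟩
    vadd F (scale F a (φ x)) (vadd F L p)            ≡⟨ cong (vadd F (scale F a (φ x))) (rowApply-affine φ-affine row s) ⟩
    vadd F (scale F a (φ x)) (vadd F (φ R) Q)         ≡⟨ regroup (φ x) (φ R) p Q ⟩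
    vadd F (comb (φ R) a (φ x) p) (vadd F (scale F a p) Q) ≡⟨ cong (λ y → vadd F y (vadd F (scale F a p) Q)) (φ-affine R a x 0v) ⟨
    vadd F (φ (comb R a x 0v)) (vadd F (scale F a p) Q) ≡⟨ cong (λ y → vadd F (φ y) (vadd F (scale F a p) Q)) (as-comb x R) ⟨
    vadd F (φ (vadd F (scale F a x) R)) (vadd F (scale F a p) Q) ∎
    where
    a : Carrier
    a = embℤ F c
    p L R Q : V _
    p = φ 0v
    L = rowApply F row (Vec.map φ s)
    R = rowApply F row s
    Q = rowApply F row (replicate _ p)
    regroup : ∀ {n} (y z p Q : V n) → vadd F (scale F a y) (vadd F z Q) ≡ vadd F (comb z a y p) (vadd F (scale F a p) Q)
    regroup [] [] [] [] = refl
    regroup (y ∷ ys) (z ∷ zs) (p ∷ ps) (q ∷ qs) = cong₂ _∷_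
      (solve 5 (λ a y z p q → a :* y :+ (z :+ q) := (z :+ a :* (y :- p)) :+ (a :* p :+ q)) refl a y z p q)
      (regroup ys zs ps qs)
    as-comb : ∀ {k} (x R : V k) → vadd F (scale F a x) R ≡ comb R a x 0v
    as-comb [] [] = refl
    as-comb (x ∷ xs) (r ∷ rs) = cong₂ _∷_
      (solve 3 (λ a x r → a :* x :+ r := r :+ a :* (x :- con 0ℤ)) refl a x r)
      (as-comb xs rs)

  module _ {k n : ℕ} {φ : V k → V n} (φ-affine : IsAffine φ) where

    -- By rowApply-affine, when Σᵢ cᵢ φ(0) = 0 we have Σᵢ cᵢ φ(sᵢ) = 0 iff φ(Σᵢ cᵢ sᵢ) = φ(0).
    rowApply-map-≡0 : ∀ {m} (row : Vec ℤ m) (s : Vec (V k) m) → rowApply F row (replicate m (φ 0v)) ≡ 0v →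
                      rowApply F row s ≡ 0v → rowApply F row (Vec.map φ s) ≡ 0v
    rowApply-map-≡0 row s Q≡0 R≡0 = vadd-cancelʳ (φ 0v) (begin
      vadd F (rowApply F row (Vec.map φ s)) (φ 0v)                      ≡⟨ rowApply-affine φ-affine row s ⟩
      vadd F (φ (rowApply F row s)) (rowApply F row (replicate _ (φ 0v))) ≡⟨ cong₂ (λ R Q → vadd F (φ R) Q) R≡0 Q≡0 ⟩
      vadd F (φ 0v) 0v                                                  ≡⟨ vadd-identityʳ (φ 0v) ⟩
      φ 0v                                                              ≡⟨ vadd-identityˡ (φ 0v) ⟨
      vadd F 0v (φ 0v)                                                  ∎)

    rowApply-unmap-≡0 : Injective _≡_ _≡_ φ → ∀ {m} (row : Vec ℤ m) (s : Vec (V k) m) →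
                        rowApply F row (replicate m (φ 0v)) ≡ 0v → rowApply F row (Vec.map φ s) ≡ 0v → rowApply F row s ≡ 0v
    rowApply-unmap-≡0 φ-injective row s Q≡0 L≡0 = φ-injective (begin
      φ (rowApply F row s)                                              ≡⟨ vadd-identityʳ _ ⟨
      vadd F (φ (rowApply F row s)) 0v                                  ≡⟨ cong (vadd F _) Q≡0 ⟨
      vadd F (φ (rowApply F row s)) (rowApply F row (replicate _ (φ 0v))) ≡⟨ rowApply-affine φ-affine row s ⟨
      vadd F (rowApply F row (Vec.map φ s)) (φ 0v)                      ≡⟨ cong (λ L → vadd F L (φ 0v)) L≡0 ⟩
      vadd F 0v (φ 0v)                                                  ≡⟨ vadd-identityˡ (φ 0v) ⟩
      φ 0v                                                              ∎)

    isSol-map : ∀ {r m} (A : Mat F r m) → IsSol F A (replicate m (φ 0v)) → (s : Vec (V k) m) → IsSol F A s → IsSol F A (Vec.map φ s)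
    isSol-map A constant s s-sol = All.zipWith (λ {row} (Q≡0 , R≡0) → rowApply-map-≡0 row s Q≡0 R≡0) (constant , s-sol)

    isSol-unmap : Injective _≡_ _≡_ φ → ∀ {r m} (A : Mat F r m) → IsSol F A (replicate m (φ 0v)) →
                  (s : Vec (V k) m) → IsSol F A (Vec.map φ s) → IsSol F A s
    isSol-unmap φ-injective A constant s φs-sol = All.zipWith (λ {row} (Q≡0 , L≡0) → rowApply-unmap-≡0 φ-injective row s Q≡0 L≡0) (constant , φs-sol)

  -- For t ≥ 0 the map fixes e₀ = 0; for t = -1 invariance translates the zero solution.
  admissible⇒constantSolution : ∀ {r m} (A : Mat F r m) t → Admissible F A t → ∀ {k n} {φ : V k → V n} →
                                 IsFixedMono (tplus1 t) φ → IsSol F A (replicate m (φ 0v))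
  admissible⇒constantSolution A (ℤ.+ t) (inj₁ _) {φ = φ} φ-fixedMono =
    subst (λ p → IsSol F A (replicate _ p)) φ0≡0 (All.tabulate λ {row} _ → rowApply-zero row)
    where
    φ0≡0 : 0v ≡ φ 0v
    φ0≡0 = begin
      0v        ≡⟨ e₀≡0v ⟨
      e 0       ≡⟨ Fixes.fixes (IsFixedMono.fixed φ-fixedMono) 0 (ℕ.m≤n+m 1 t) ⟨
      φ (e 0)   ≡⟨ cong φ e₀≡0v ⟩
      φ 0v      ∎
  admissible⇒constantSolution {m = m} A t (inj₂ (_ , invariant)) {n = n} {φ} _ =
    subst (IsSol F A) translate (invariant n (replicate m 0v) (φ 0v) (All.tabulate λ {row} _ → rowApply-zero row))
    where
    translate : Vec.map (vadd F (φ 0v)) (replicate m 0v) ≡ replicate m (φ 0v)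
    translate = trans (Vecₚ.map-replicate (vadd F (φ 0v)) 0v m) (cong (replicate m) (vadd-identityʳ (φ 0v)))

module Reparametrisations (F : FiniteField) where

  open import Defs hiding (Injective)
  open AffineMaps F
  open FiniteDimension F
  open Charts F
  open AffineMatrices F
  open import Data.Nat using (ℕ)
  open import Data.List.Relation.Unary.All as All using (All)
  open import Data.List.Relation.Unary.Any using (Any; any?)
  open import Data.Product using (Σ; _×_; _,_)
  open import Function using (_∘_)
  open import Relation.Nullary using (Dec; _×-dec_)
  open import Relation.Binary.Definitions using (DecidableEquality)
  open import Relation.Binary.PropositionalEquality

  Reparametrisation : ∀ {k} {X : Set} → ℕ → (V k → X) → (V k → X) → Set
  Reparametrisation {k} u g₁ g₂ =
    Any (λ ψ → Fixed F u ψ × Bijective F ψ × All (λ x → g₁ x ≡ g₂ (apply F ψ x)) (pts F k)) (affs F k k)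

  _≈[_]_ : ∀ {k} {X : Set} → (V k → X) → ℕ → (V k → X) → Set
  _≈[_]_ {k} g₁ u g₂ = Σ (Automorphism u k) λ ψ → ∀ x → g₁ x ≡ g₂ (Automorphism.to ψ x)

  module _ {k : ℕ} {X : Set} {u : ℕ} where

    reparametrisation? : DecidableEquality X → (g₁ g₂ : V k → X) → Dec (Reparametrisation u g₁ g₂)
    reparametrisation? _≟_ g₁ g₂ =
      any? (λ ψ → fixed? F u ψ ×-dec bijective? F ψ ×-dec All.all? (λ x → g₁ x ≟ g₂ (apply F ψ x)) (pts F k)) (affs F k k)

    Reparametrisation⇒≈ : (g₁ g₂ : V k → X) → Reparametrisation u g₁ g₂ → g₁ ≈[ u ] g₂
    Reparametrisation⇒≈ _ _ reparam with Any-affs⇒ reparam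
    ... | ψ , ψ-fixed , (ψ-injective , _) , g₁≗g₂∘ψ =
      automorphism (Aff⇒fixedMono ψ ψ-fixed ψ-injective) , λ x → All.lookup g₁≗g₂∘ψ (pts-complete x)

    ≈⇒Reparametrisation : (g₁ g₂ : V k → X) → g₁ ≈[ u ] g₂ → Reparametrisation u g₁ g₂
    ≈⇒Reparametrisation g₁ g₂ (ψ , g₁≗g₂∘ψ) with fixedMono⇒Aff (Automorphism.to-fixedMono ψ)
    ... | ψA , ψA≗ψ , ψA-fixed , ψA-injective = Any-affs⇐ ψA
      (ψA-fixed , (ψA-injective , Surjective⇐ ψA onto) , All.tabulate λ {x} _ → trans (g₁≗g₂∘ψ x) (cong g₂ (sym (ψA≗ψ x))))
      where
      open Automorphism ψ
      onto : ∀ y → Im (apply F ψA) y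
      onto y = from y , trans (ψA≗ψ (from y)) (to∘from y)

    ≈-sym : {g₁ g₂ : V k → X} → g₁ ≈[ u ] g₂ → g₂ ≈[ u ] g₁
    ≈-sym {g₁} {g₂} (ψ , g₁≗g₂∘ψ) = automorphism-inverse ψ , λ x → trans (cong g₂ (sym (to∘from x))) (sym (g₁≗g₂∘ψ (from x)))
      where open Automorphism ψ

    ≈-trans : {g₁ g₂ g₃ : V k → X} → g₁ ≈[ u ] g₂ → g₂ ≈[ u ] g₃ → g₁ ≈[ u ] g₃
    ≈-trans (ψ , g₁≗g₂∘ψ) (χ , g₂≗g₃∘χ) = automorphism-∘ χ ψ , λ x → trans (g₁≗g₂∘ψ x) (g₂≗g₃∘χ _)

    reparametrisation-sym : {g₁ g₂ : V k → X} → Reparametrisation u g₁ g₂ → Reparametrisation u g₂ g₁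
    reparametrisation-sym {g₁} {g₂} = ≈⇒Reparametrisation g₂ g₁ ∘ ≈-sym {g₁ = g₁} {g₂ = g₂} ∘ Reparametrisation⇒≈ g₁ g₂

    reparametrisation-trans : {g₁ g₂ g₃ : V k → X} → Reparametrisation u g₁ g₂ → Reparametrisation u g₂ g₃ → Reparametrisation u g₁ g₃
    reparametrisation-trans {g₁} {g₂} {g₃} r s =
      ≈⇒Reparametrisation g₁ g₃ (≈-trans {g₁ = g₁} {g₂ = g₂} {g₃ = g₃} (Reparametrisation⇒≈ g₁ g₂ r) (Reparametrisation⇒≈ g₂ g₃ s))

module DoubleCounting (F : FiniteField) (t : ℤ) {r m : ℕ} (A : Mat F r m) (admissible : Admissible F A t) (D : ℕ) where

  open import Defs hiding (Injective)
  open import Data.Integer using (ℤ)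
  open import Data.Nat using (ℕ)
  open Counting
  open AffineMaps F
  open FiniteDimension F
  open Charts F
  open AffineMatrices F
  open Subspaces F
  open Solutions F
  open Reparametrisations F
  open import Data.Nat as ℕ using (_≤_; _<_; _*_; _∸_; s≤s)
  import Data.Nat.Properties as ℕ
  open import Data.Nat.ListAction using (sum)
  open import Data.Fin using (Fin)
  open import Data.Vec as Vec using (Vec; []; _∷_; toList)
  import Data.Vec.Properties as Vecₚ
  open import Data.List using (List; []; _∷_; map; length)
  open import Data.List.Properties using (map-cong-local; filter-some)
  open import Data.List.Membership.Propositional using (_∈_; lose; find)
  open import Data.List.Membership.Propositional.Properties using (∈-map⁺; ∈-map⁻)
  open import Data.List.Relation.Unary.All as All using (All; []; _∷_; all?)
  open import Data.List.Relation.Unary.Any as Any using (Any; here)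
  import Data.List.Relation.Unary.AllPairs as AllPairs
  open import Data.List.Relation.Unary.Unique.Propositional using (Unique)
  import Data.List.Relation.Unary.AllPairs.Properties as AllPairsₚ
  open import Data.Product using (Σ; _×_; _,_; proj₁; proj₂)
  open import Data.Unit using (⊤; tt)
  open import Function using (Injective; _∘_; id)
  open import Relation.Nullary using (Dec; yes; _×-dec_)
  open import Relation.Unary using (Decidable)
  open import Relation.Binary.PropositionalEquality
  open ≡-Reasoning

  u : ℕ
  u = tplus1 t

  candidates : ∀ n → List (Vec (V n) m)
  candidates n = vecsOf (pts F n) m

  candidates-complete : ∀ {n} (s : Vec (V n) m) → s ∈ candidates n
  candidates-complete = vecsOf-complete pts-complete

  candidates-unique : ∀ n → Unique (candidates n)
  candidates-unique n = vecsOf-unique (pts-unique n) m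

  InS : ∀ {n} → (V n → Set) → Vec (V n) m → Set
  InS T s = All T (toList s) × IsSol F A s × DimIs F t s D

  inS? : ∀ {n} {T : V n → Set} → Decidable T → Decidable (InS T)
  inS? T? s = all? T? (toList s) ×-dec isSol? F A s ×-dec dimIs? F t D s

  inImage? : ∀ {k n} (φ : V k → V n) → Decidable (λ (s : Vec (V n) m) → All (Im φ) (toList s))
  inImage? φ s = all? (im? φ) (toList s)

  unmap : ∀ {k n l} {φ : V k → V n} (s′ : Vec (V n) l) → All (Im φ) (toList s′) → Σ (Vec (V k) l) λ s → Vec.map φ s ≡ s′
  unmap [] [] = [] , refl
  unmap (y ∷ s′) ((x , φx≡y) ∷ s′⊆φ) = let (s , φs≡s′) = unmap s′ s′⊆φ in x ∷ s , cong₂ _∷_ φx≡y φs≡s′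

  map-injective : ∀ {k n l} {φ : V k → V n} → Injective _≡_ _≡_ φ → Injective _≡_ _≡_ (Vec.map {n = l} φ)
  map-injective φ-injective {[]} {[]} _ = refl
  map-injective φ-injective {x ∷ s} {y ∷ s′} eq =
    cong₂ _∷_ (φ-injective (Vecₚ.∷-injectiveˡ eq)) (map-injective φ-injective (Vecₚ.∷-injectiveʳ eq))

  -- s ↦ φ ∘ s is a bijection onto the members of S^t_L(T) inside the image of φ.
  countSt-pullback : ∀ {k n} {φ : V k → V n} → IsFixedMono u φ → {T : V n → Set} (T? : Decidable T) →
                     countSt F A t D k (T ∘ φ) (T? ∘ φ) ≡ count (λ s → inS? T? s ×-dec inImage? φ s) (candidates n)
  countSt-pullback {k} {n} {φ} φ-fixedMono {T} T? =
    count-injection (inS? (T? ∘ φ)) (λ s → inS? T? s ×-dec inImage? φ s)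
      (candidates-unique k) (candidates-unique n) candidates-complete candidates-complete
      (Vec.map φ) (map-injective injective) forward backward
    where
    open IsFixedMono φ-fixedMono
    constant : IsSol F A (Vec.replicate m (φ 0v))
    constant = admissible⇒constantSolution A t admissible φ-fixedMono
    forward : ∀ {s} → InS (T ∘ φ) s → InS T (Vec.map φ s) × All (Im φ) (toList (Vec.map φ s))
    forward {s} (s⊆T , sol , dim) =
      (All-toList-map⁺ φ s⊆T , isSol-map affine A constant s sol , HasDim⇒DimIs t _ D (hasDim-map φ-fixedMono (DimIs⇒HasDim t s D dim))) ,
      All-toList-map⁺ φ (All.tabulate λ {x} _ → x , refl)
    backward : ∀ {s′} → InS T s′ × All (Im φ) (toList s′) → Σ (Vec (V k) m) λ s → InS (T ∘ φ) s × Vec.map φ s ≡ s′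
    backward {s′} ((s′⊆T , sol , dim) , s′⊆φ) with unmap s′ s′⊆φ
    ... | s , refl = s , (All-toList-map⁻ φ s′⊆T , isSol-unmap affine injective A constant s sol ,
                          HasDim⇒DimIs t s D (hasDim-unmap φ-fixedMono (DimIs⇒HasDim t _ D dim))) , refl

  colourCount : ∀ {c k} → Coloring F c k → Fin c → ℕ
  colourCount {k = k} δ i = countSt F A t D k (Class F δ i) (class? F δ i)

  colourCount-≈ : ∀ {c k} {δ₁ δ₂ : Coloring F c k} (i : Fin c) → δ₁ ≈[ u ] δ₂ → colourCount δ₁ i ≡ colourCount δ₂ i
  colourCount-≈ {k = k} {δ₁} {δ₂} i (ψ , δ₁≗δ₂∘ψ) = begin
    colourCount δ₁ i
      ≡⟨ count-cong (inS? (class? F δ₁ i)) (inS? (class? F δ₂ i ∘ to)) (candidates k)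
           (λ _ (s⊆ , rest) → All.map (trans (sym (δ₁≗δ₂∘ψ _))) s⊆ , rest)
           (λ _ (s⊆ , rest) → All.map (trans (δ₁≗δ₂∘ψ _)) s⊆ , rest) ⟩
    countSt F A t D k (Class F δ₂ i ∘ to) (class? F δ₂ i ∘ to)
      ≡⟨ countSt-pullback to-fixedMono (class? F δ₂ i) ⟩
    count (λ s → inS? (class? F δ₂ i) s ×-dec inImage? to s) (candidates k)
      ≡⟨ count-cong _ (inS? (class? F δ₂ i)) (candidates k) (λ _ → proj₁)
           (λ _ s∈ → s∈ , All.tabulate λ {y} _ → from y , to∘from y) ⟩
    colourCount δ₂ i ∎
    where open Automorphism ψ

  through : ∀ {k n} → List (Aff F k n) → Vec (V n) m → ℕ
  through M s = count (λ φ → inImage? (apply F φ) s) M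

  double-counting-constant : ∀ {k n} (M : List (Aff F k n)) (N : ℕ) → (∀ s → DimIs F t s D → through M s ≡ N) →
                             {T : V n → Set} (T? : Decidable T) →
                             sum (map (λ s → through M s * indicator (inS? T?) s) (candidates n)) ≡ N * count (inS? T?) (candidates n)
  double-counting-constant {n = n} M N through≡N T? = begin
    sum (map (λ s → through M s * indicator (inS? T?) s) (candidates n))
      ≡⟨ cong sum (map-cong-local {xs = candidates n} (All.tabulate λ {s} _ → *-indicator-cong (inS? T?) s λ (_ , _ , dim) → through≡N s dim)) ⟩
    sum (map (λ s → N * indicator (inS? T?) s) (candidates n))
      ≡⟨ sum-map-*ˡ N _ (candidates n) ⟩
    N * sum (map (indicator (inS? T?)) (candidates n))
      ≡⟨ cong (N *_) (count≡sum-indicator (inS? T?) (candidates n)) ⟨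
    N * count (inS? T?) (candidates n) ∎

  monEquiv? : ∀ {k n} (φ φ′ : Aff F k n) → Dec (MonEquiv F t φ φ′)
  monEquiv? φ φ′ = reparametrisation? (_≟v_ F) (apply F φ′) (apply F φ)

  monEquiv-sym : ∀ {k n} {φ φ′ : Aff F k n} → MonEquiv F t φ φ′ → MonEquiv F t φ′ φ
  monEquiv-sym {φ = φ} {φ′} = reparametrisation-sym {g₁ = apply F φ′} {g₂ = apply F φ}

  monEquiv-trans : ∀ {k n} {φ φ′ φ″ : Aff F k n} → MonEquiv F t φ φ′ → MonEquiv F t φ′ φ″ → MonEquiv F t φ φ″
  monEquiv-trans {φ = φ} {φ′} {φ″} e e′ = reparametrisation-trans {g₁ = apply F φ″} {g₂ = apply F φ′} {g₃ = apply F φ} e′ e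

  dimL⇒≤ : DimL F A t D → u ∸ 1 ≤ D
  dimL⇒≤ ((_ , _ , _ , u∸1≤D , _) , _) = u∸1≤D

  solution-exists : DimL F A t D → ∀ {n} → D ≤ n → Σ (Vec (V n) m) λ s → IsSol F A s × DimIs F t s D
  solution-exists ((n₀ , s₀ , sol₀ , dim₀) , _) D≤n with DimIs⇒HasDim t s₀ D dim₀
  ... | hasDim₀ with HasDim.inSubspace hasDim₀
  ...   | ψ , ψ-fixedMono , s₀⊆ψ with unmap s₀ s₀⊆ψ
  ...     | s′ , refl = Vec.map (pad D≤n) s′ ,
                       isSol-map (IsFixedMono.affine pad-fixedMono′) A (admissible⇒constantSolution A t admissible pad-fixedMono′) s′ sol′ ,
                       HasDim⇒DimIs t _ D (hasDim-map pad-fixedMono′ (hasDim-unmap ψ-fixedMono hasDim₀))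
    where
    pad-fixedMono′ : IsFixedMono u (pad D≤n)
    pad-fixedMono′ = pad-fixedMono D≤n (Fixes.u≤1+k (IsFixedMono.fixed ψ-fixedMono))
    sol′ : IsSol F A s′
    sol′ = isSol-unmap (IsFixedMono.affine ψ-fixedMono) (IsFixedMono.injective ψ-fixedMono) A
             (admissible⇒constantSolution A t admissible ψ-fixedMono) s′ sol₀

  solutions-nonempty : DimL F A t D → ∀ {n} → D ≤ n → 0 < countSt F A t D n (λ _ → ⊤) (λ _ → yes tt)
  solutions-nonempty dimL D≤n with solution-exists dimL D≤n
  ... | s , sol , dim = filter-some (inS? (λ _ → yes tt)) (lose (candidates-complete s) (All.tabulate (λ _ → tt) , sol , dim))

  module MonomorphismRepresentatives {k n : ℕ} (M : List (Aff F k n)) (reps : IsMonReps F k n t M) where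

    member-fixedMono : ∀ {φ} → φ ∈ M → IsFixedMono u (apply F φ)
    member-fixedMono {φ} φ∈M = Aff⇒fixedMono φ (proj₁ (All.lookup (proj₁ reps) φ∈M)) (proj₂ (All.lookup (proj₁ reps) φ∈M))

    represented : ∀ {f : V k → V n} → IsFixedMono u f → Σ (Aff F k n) λ φ → φ ∈ M × apply F φ ≈[ u ] f
    represented f-fixedMono with fixedMono⇒Aff f-fixedMono
    ... | fA , fA≗f , fA-fixed , fA-injective with find (proj₁ (proj₂ reps) fA fA-fixed fA-injective)
    ... | φ , φ∈M , fA~φ with Reparametrisation⇒≈ (apply F φ) (apply F fA) fA~φ
    ... | ψ , φ≗fA∘ψ = φ , φ∈M , ψ , λ x → trans (φ≗fA∘ψ x) (fA≗f _)

    representatives-nonempty : k ≤ n → u ∸ 1 ≤ k → 0 < length M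
    representatives-nonempty k≤n u∸1≤k with represented (pad-fixedMono k≤n (ℕ.≤-trans (ℕ.m≤n+m∸n u 1) (s≤s u∸1≤k)))
    ... | _ , φ∈M , _ = nonempty φ∈M
      where
      nonempty : ∀ {φ} {M′ : List (Aff F k n)} → φ ∈ M′ → 0 < length M′
      nonempty (here _) = s≤s ℕ.z≤n
      nonempty (Any.there _) = s≤s ℕ.z≤n

    Covers : (V D → V n) → Aff F k n → Set
    Covers ψ φ = All (λ x → Im (apply F φ) (ψ x)) (pts F D)

    covers? : (ψ : V D → V n) → Decidable (Covers ψ)
    covers? ψ φ = all? (λ x → im? (apply F φ) (ψ x)) (pts F D)

    -- By minimality, a representative contains s exactly when it contains the whole D-dimensional subspace through s.
    through≡covers : ∀ {s : Vec (V n) m} (hasDim : HasDim u s D) {s₀} → s₀ ∈ toList s →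
                     through M s ≡ count (covers? (proj₁ (HasDim.inSubspace hasDim))) M
    through≡covers hasDim s₀∈s with HasDim.inSubspace hasDim
    ... | ψ , ψ-fixedMono , s⊆ψ = count-cong (λ φ → inImage? (apply F φ) _) (covers? ψ) M
      (λ φ∈M s⊆φ → All.tabulate λ {x} _ → minimal-⊆ ψ-fixedMono s⊆ψ (HasDim.minimal hasDim) s₀∈s (member-fixedMono φ∈M) s⊆φ x)
      (λ _ ψ⊆φ → All.map (λ (x , ψx≡y) → subst (Im _) ψx≡y (All.lookup ψ⊆φ (pts-complete x))) s⊆ψ)

    module _ (g : Automorphism u n) where
      open Automorphism g

      postcompose : Aff F k n → Aff F k n
      postcompose φ = proj₁ (toAff (to ∘ apply F φ) (affine-∘ (IsFixedMono.affine to-fixedMono) (apply-affine φ)))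

      apply-postcompose : ∀ φ x → apply F (postcompose φ) x ≡ to (apply F φ x)
      apply-postcompose φ = proj₂ (toAff (to ∘ apply F φ) (affine-∘ (IsFixedMono.affine to-fixedMono) (apply-affine φ)))

      postcompose-cancel : ∀ {φ φ′} → MonEquiv F t (postcompose φ) (postcompose φ′) → MonEquiv F t φ φ′
      postcompose-cancel {φ} {φ′} e with Reparametrisation⇒≈ (apply F (postcompose φ′)) (apply F (postcompose φ)) e
      ... | χ , eq = ≈⇒Reparametrisation (apply F φ′) (apply F φ) (χ , λ x → IsFixedMono.injective to-fixedMono
                       (trans (sym (apply-postcompose φ′ x)) (trans (eq x) (apply-postcompose φ _))))

      member⇒postcomposed : ∀ {φ} → φ ∈ M → Any (MonEquiv F t φ) (map postcompose M)
      member⇒postcomposed {φ} φ∈M with represented (fixedMono-∘ from-fixedMono (member-fixedMono φ∈M))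
      ... | φ″ , φ″∈M , χ , φ″≗ = lose (∈-map⁺ postcompose φ″∈M) (≈⇒Reparametrisation (apply F (postcompose φ″)) (apply F φ)
            (χ , λ x → trans (apply-postcompose φ″ x) (trans (cong to (φ″≗ x)) (to∘from _))))

      postcomposed⇒member : ∀ {φ′} → φ′ ∈ map postcompose M → Any (MonEquiv F t φ′) M
      postcomposed⇒member φ′∈ with ∈-map⁻ postcompose φ′∈
      ... | φ , φ∈M , refl = proj₁ (proj₂ reps) (postcompose φ)
        (proj₂ (Fixed⇔Fixes (postcompose φ)) (IsFixedMono.fixed post-fixedMono)) (Injective⇐ (postcompose φ) (IsFixedMono.injective post-fixedMono))
        where
        post-fixedMono : IsFixedMono u (apply F (postcompose φ))
        post-fixedMono = fixedMono-≗ (fixedMono-∘ to-fixedMono (member-fixedMono φ∈M)) (apply-postcompose φ)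

      covers-postcompose : ∀ {ψ₁ ψ₂ : V D → V n} → (∀ x → to (ψ₁ x) ≡ ψ₂ x) → ∀ φ →
                           (Covers ψ₁ φ → Covers ψ₂ (postcompose φ)) × (Covers ψ₂ (postcompose φ) → Covers ψ₁ φ)
      covers-postcompose {ψ₁} {ψ₂} g∘ψ₁≗ψ₂ φ =
        (λ c → All.tabulate λ {x} _ → let (y , φy≡ψ₁x) = All.lookup c (pts-complete x) in
                 y , trans (apply-postcompose φ y) (trans (cong to φy≡ψ₁x) (g∘ψ₁≗ψ₂ x))) ,
        (λ c → All.tabulate λ {x} _ → let (y , gφy≡ψ₂x) = All.lookup c (pts-complete x) in
                 y , IsFixedMono.injective to-fixedMono (trans (sym (apply-postcompose φ y)) (trans gφy≡ψ₂x (sym (g∘ψ₁≗ψ₂ x)))))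

    covers-respects : ∀ {ψ} {φ φ′} → MonEquiv F t φ φ′ → Covers ψ φ → Covers ψ φ′
    covers-respects {φ = φ} {φ′} e c with Reparametrisation⇒≈ (apply F φ′) (apply F φ) e
    ... | χ , φ′≗φ∘χ = All.map (λ (y , φy≡) → Automorphism.from χ y , trans (φ′≗φ∘χ _) (trans (cong (apply F φ) (Automorphism.to∘from χ y)) φy≡)) c

    open Transversal (MonEquiv F {k} {n} t) monEquiv? monEquiv-sym monEquiv-trans using (Irredundant; count-transversal)

    -- Transport ψ₁ to ψ₂ by an automorphism g; postcomposing with g permutes the classes of Mon_t(k;n).
    covers-invariant : ∀ {ψ₁ ψ₂ : V D → V n} → IsFixedMono u ψ₁ → IsFixedMono u ψ₂ → count (covers? ψ₁) M ≡ count (covers? ψ₂) M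
    covers-invariant {ψ₁} {ψ₂} ψ₁-fixedMono ψ₂-fixedMono with transport ψ₁-fixedMono ψ₂-fixedMono
    ... | g , g∘ψ₁≗ψ₂ = begin
      count (covers? ψ₁) M
        ≡⟨ count-cong (covers? ψ₁) (covers? ψ₂ ∘ postcompose g) M (λ {φ} _ → proj₁ (covers-postcompose g g∘ψ₁≗ψ₂ φ))
                                                                (λ {φ} _ → proj₂ (covers-postcompose g g∘ψ₁≗ψ₂ φ)) ⟩
      count (covers? ψ₂ ∘ postcompose g) M
        ≡⟨ count-map (covers? ψ₂) (postcompose g) M ⟨
      count (covers? ψ₂) (map (postcompose g) M)
        ≡⟨ count-transversal (covers? ψ₂) covers-respects postcomposed-irredundant (proj₂ (proj₂ reps))
             (postcomposed⇒member g) (member⇒postcomposed g) ⟩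
      count (covers? ψ₂) M ∎
      where
      postcomposed-irredundant : Irredundant (map (postcompose g) M)
      postcomposed-irredundant = AllPairsₚ.map⁺ (AllPairs.map (λ φ≁φ′ e → φ≁φ′ (postcompose-cancel g e)) (proj₂ (proj₂ reps)))

    through-constant : ∀ {s₁ s₂ : Vec (V n) m} → DimIs F t s₁ D → DimIs F t s₂ D → through M s₁ ≡ through M s₂
    through-constant {[]} {[]} _ _ = refl
    through-constant {x ∷ s₁} {y ∷ s₂} dim₁ dim₂ = begin
      through M (x ∷ s₁)                  ≡⟨ through≡covers hasDim₁ (here refl) ⟩
      count (covers? (proj₁ subspace₁)) M ≡⟨ covers-invariant (proj₁ (proj₂ subspace₁)) (proj₁ (proj₂ subspace₂)) ⟩
      count (covers? (proj₁ subspace₂)) M ≡⟨ through≡covers hasDim₂ (here refl) ⟨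
      through M (y ∷ s₂)                  ∎
      where
      hasDim₁ : HasDim u (x ∷ s₁) D
      hasDim₁ = DimIs⇒HasDim t (x ∷ s₁) D dim₁
      hasDim₂ : HasDim u (y ∷ s₂) D
      hasDim₂ = DimIs⇒HasDim t (y ∷ s₂) D dim₂
      subspace₁ : InSubspace u D (x ∷ s₁)
      subspace₁ = HasDim.inSubspace hasDim₁
      subspace₂ : InSubspace u D (y ∷ s₂)
      subspace₂ = HasDim.inSubspace hasDim₂

    pullbackSum : {T : V n → Set} → Decidable T → ℕ
    pullbackSum {T} T? = sum (map (λ φ → countSt F A t D k (T ∘ apply F φ) (T? ∘ apply F φ)) M)

    sum-countSt-pullbacks : ∀ {s* : Vec (V n) m} → DimIs F t s* D → {T : V n → Set} (T? : Decidable T) →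
                            pullbackSum T? ≡ through M s* * countSt F A t D n T T?
    sum-countSt-pullbacks {s*} dim* T? = begin
      sum (map (λ φ → countSt F A t D k _ (T? ∘ apply F φ)) M)
        ≡⟨ cong sum (map-cong-local {xs = M} (All.tabulate λ φ∈M → countSt-pullback (member-fixedMono φ∈M) T?)) ⟩
      sum (map (λ φ → count (λ s → inS? T? s ×-dec inImage? (apply F φ) s) (candidates n)) M)
        ≡⟨ double-counting (inS? T?) (λ s φ → inImage? (apply F φ) s) (candidates n) M ⟩
      sum (map (λ s → through M s * indicator (inS? T?) s) (candidates n))
        ≡⟨ double-counting-constant M (through M s*) (λ s dim → through-constant dim dim*) T? ⟩
      through M s* * countSt F A t D n _ T? ∎

  sum-over-colourings : ∀ {c k n} (R : List (Coloring F c k)) → IsColReps F k t R → (M : List (Aff F k n)) (γ : Coloring F c n) (i : Fin c) →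
                        sum (map (λ δ → colourCount δ i * count (λ φ → iso? F t (γ ∘ apply F φ) δ) M) R)
                        ≡ sum (map (λ φ → colourCount (γ ∘ apply F φ) i) M)
  sum-over-colourings {c} {k} R (complete , irredundant) M γ i = begin
    sum (map (λ δ → f δ * count (λ φ → iso? F t (γ ∘ apply F φ) δ) M) R)
      ≡⟨ cong sum (map-cong-local {xs = R} (All.tabulate λ {δ} _ → trans (cong (f δ *_) (count≡sum-indicator _ M)) (sym (sum-map-*ˡ (f δ) _ M)))) ⟩
    sum (map (λ δ → sum (map (λ φ → f δ * indicator (λ φ → iso? F t (γ ∘ apply F φ) δ) φ) M)) R)
      ≡⟨ sum-map-comm (λ δ φ → f δ * indicator (λ φ → iso? F t (γ ∘ apply F φ) δ) φ) R M ⟩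
    sum (map (λ φ → sum (map (λ δ → f δ * indicator (λ φ → iso? F t (γ ∘ apply F φ) δ) φ) R)) M)
      ≡⟨ cong sum (map-cong-local {xs = M} (All.tabulate λ {φ} _ → trans (cong sum (map-cong-local {xs = R} (All.tabulate λ {δ} _ →
           trans (ℕ.*-comm (f δ) _) (cong (_* f δ) (indicator-cong (λ φ → iso? F t (γ ∘ apply F φ) δ) (iso? F t (γ ∘ apply F φ)) {φ} {δ} id id)))))
           (sum-transversal f irredundant (complete (γ ∘ apply F φ)) (f-resp φ)))) ⟩
    sum (map (λ φ → f (γ ∘ apply F φ)) M) ∎
    where
    f : Coloring F c k → ℕ
    f δ = colourCount δ i
    open Transversal (Iso F {c} {k} t) (iso? F t) (λ {γ₁} {γ₂} → reparametrisation-sym {g₁ = γ₁} {g₂ = γ₂})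
                     (λ {γ₁} {γ₂} {γ₃} → reparametrisation-trans {g₁ = γ₁} {g₂ = γ₂} {g₃ = γ₃}) using (sum-transversal)
    f-resp : ∀ φ {δ} → Iso F t (γ ∘ apply F φ) δ → f δ ≡ f (γ ∘ apply F φ)
    f-resp φ {δ} γφ≅δ = sym (colourCount-≈ i (Reparametrisation⇒≈ (γ ∘ apply F φ) δ γφ≅δ))

module Fractions where

  open import Defs using (frac; sumℚ)
  open import Data.Nat as ℕ using (ℕ; zero; suc; _+_; _*_; _<_)
  import Data.Nat.Properties as ℕ
  open import Data.Nat.Solver using (module +-*-Solver)
  open import Data.Nat.ListAction using (sum)
  import Data.Integer as ℤ
  import Data.Integer.Properties as ℤ
  open import Data.Rational as ℚ using (ℚ)
  import Data.Rational.Properties as ℚ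
  open import Data.Rational.Unnormalised as ℚᵘ using (ℚᵘ; mkℚᵘ; *≡*)
  import Data.Rational.Unnormalised.Properties as ℚᵘ
  open import Data.List using (List; []; _∷_; map)
  open import Data.Empty using (⊥-elim)
  open import Data.List.Properties using (map-cong)
  open import Relation.Binary.PropositionalEquality
  open ≡-Reasoning
  open +-*-Solver using (solve; _:=_; _:+_; _:*_)

  toℚᵘ-frac : ∀ a b → ℚ.toℚᵘ (frac a (suc b)) ℚᵘ.≃ mkℚᵘ (ℤ.+ a) b
  toℚᵘ-frac a b = ℚ.toℚᵘ-fromℚᵘ (mkℚᵘ (ℤ.+ a) b)

  ℚᵘ-cross : ∀ {x y : ℚᵘ} {a b c d : ℕ} → ℚᵘ.↥ x ≡ ℤ.+ a → ℚᵘ.↧ x ≡ ℤ.+ b → ℚᵘ.↥ y ≡ ℤ.+ c → ℚᵘ.↧ y ≡ ℤ.+ d →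
             a * d ≡ c * b → x ℚᵘ.≃ y
  ℚᵘ-cross {x} {y} {a} {b} {c} {d} ↥x ↧x ↥y ↧y a*d≡c*b = *≡* (begin
    ℚᵘ.↥ x ℤ.* ℚᵘ.↧ y   ≡⟨ cong₂ ℤ._*_ ↥x ↧y ⟩
    ℤ.+ a ℤ.* ℤ.+ d     ≡⟨ ℤ.pos-* a d ⟨
    ℤ.+ (a * d)         ≡⟨ cong ℤ.+_ a*d≡c*b ⟩
    ℤ.+ (c * b)         ≡⟨ ℤ.pos-* c b ⟩
    ℤ.+ c ℤ.* ℤ.+ b     ≡⟨ cong₂ ℤ._*_ ↥y ↧x ⟨
    ℚᵘ.↥ y ℤ.* ℚᵘ.↧ x   ∎)

  frac-cross : ∀ a b c d → a * suc d ≡ c * suc b → frac a (suc b) ≡ frac c (suc d)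
  frac-cross a b c d eq = ℚ.toℚᵘ-injective
    (ℚᵘ.≃-trans (toℚᵘ-frac a b) (ℚᵘ.≃-trans (ℚᵘ-cross refl refl refl refl eq) (ℚᵘ.≃-sym (toℚᵘ-frac c d))))

  frac-* : ∀ a b c d → frac a (suc b) ℚ.* frac c (suc d) ≡ frac (a * c) (suc b * suc d)
  frac-* a b c d = ℚ.toℚᵘ-injective (ℚᵘ.≃-trans (ℚ.toℚᵘ-homo-* (frac a (suc b)) (frac c (suc d)))
    (ℚᵘ.≃-trans (ℚᵘ.*-cong (toℚᵘ-frac a b) (toℚᵘ-frac c d))
    (ℚᵘ.≃-trans (ℚᵘ-cross (sym (ℤ.pos-* a c)) refl refl refl refl) (ℚᵘ.≃-sym (toℚᵘ-frac (a * c) (d + b * suc d))))))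

  frac-+ : ∀ a c b → frac a (suc b) ℚ.+ frac c (suc b) ≡ frac (a + c) (suc b)
  frac-+ a c b = ℚ.toℚᵘ-injective (ℚᵘ.≃-trans (ℚ.toℚᵘ-homo-+ (frac a (suc b)) (frac c (suc b)))
    (ℚᵘ.≃-trans (ℚᵘ.+-cong (toℚᵘ-frac a b) (toℚᵘ-frac c b))
    (ℚᵘ.≃-trans (ℚᵘ-cross (sym numerator) refl refl refl cross) (ℚᵘ.≃-sym (toℚᵘ-frac (a + c) b)))))
    where
    numerator : ℤ.+ (a * suc b + c * suc b) ≡ ℤ.+ a ℤ.* ℤ.+ suc b ℤ.+ ℤ.+ c ℤ.* ℤ.+ suc b
    numerator = trans (ℤ.pos-+ (a * suc b) (c * suc b)) (cong₂ ℤ._+_ (ℤ.pos-* a (suc b)) (ℤ.pos-* c (suc b)))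
    cross : (a * suc b + c * suc b) * suc b ≡ (a + c) * (suc b * suc b)
    cross = solve 3 (λ a c B → (a :* B :+ c :* B) :* B := (a :+ c) :* (B :* B)) refl a c (suc b)

  sumℚ-frac : ∀ {A : Set} (g : A → ℕ) b (R : List A) → sumℚ (map (λ x → frac (g x) (suc b)) R) ≡ frac (sum (map g R)) (suc b)
  sumℚ-frac g b [] = sym (ℚ.0/n≡0 (suc b))
  sumℚ-frac g b (x ∷ R) = trans (cong (frac (g x) (suc b) ℚ.+_) (sumℚ-frac g b R)) (frac-+ (g x) (sum (map g R)) b)

  frac≡weighted-sum : ∀ {Δ : Set} (a b bₖ m N : ℕ) (f y : Δ → ℕ) (R : List Δ) → 0 < bₖ → 0 < m →
                 sum (map (λ δ → f δ * y δ) R) ≡ a * N → m * bₖ ≡ b * N →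
                 frac a b ≡ sumℚ (map (λ δ → frac (f δ) bₖ ℚ.* frac (y δ) m) R)
  frac≡weighted-sum a zero (suc bₖ) (suc m) N f y R _ _ _ m*bₖ≡0 = ⊥-elim (ℕ.0≢1+n (sym m*bₖ≡0))
  frac≡weighted-sum a (suc b) (suc bₖ) (suc m) N f y R _ _ Σfy≡aN m*bₖ≡bN = sym (begin
    sumℚ (map (λ δ → frac (f δ) (suc bₖ) ℚ.* frac (y δ) (suc m)) R)
      ≡⟨ cong sumℚ (map-cong (λ δ → frac-* (f δ) bₖ (y δ) m) R) ⟩
    sumℚ (map (λ δ → frac (f δ * y δ) (suc bₖ * suc m)) R)
      ≡⟨ sumℚ-frac (λ δ → f δ * y δ) (m + bₖ * suc m) R ⟩
    frac (sum (map (λ δ → f δ * y δ) R)) (suc bₖ * suc m)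
      ≡⟨ cong (λ z → frac z (suc bₖ * suc m)) Σfy≡aN ⟩
    frac (a * N) (suc bₖ * suc m)
      ≡⟨ frac-cross (a * N) (m + bₖ * suc m) a b cross ⟩
    frac a (suc b) ∎)
    where
    cross : a * N * suc b ≡ a * (suc bₖ * suc m)
    cross = begin
      a * N * suc b            ≡⟨ ℕ.*-assoc a N (suc b) ⟩
      a * (N * suc b)          ≡⟨ cong (a *_) (trans (ℕ.*-comm N (suc b)) (sym m*bₖ≡bN)) ⟩
      a * (suc m * suc bₖ)     ≡⟨ cong (a *_) (ℕ.*-comm (suc m) (suc bₖ)) ⟩
      a * (suc bₖ * suc m)     ∎


open import Defs
open import Data.Nat using (ℕ; _≤_)
open import Data.Nat.Coprimality using (Coprime)
open import Data.Integer using (ℤ; ∣_∣; -1ℤ) renaming (_≤_ to _≤ℤ_)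
open import Data.Fin using (Fin)
open import Data.Vec using (Vec)
open import Data.List using (List; map)
open import Data.List.Relation.Unary.All using (All)
open import Data.Rational using (ℚ; _*_)
open import Relation.Binary.PropositionalEquality using (_≡_)

open Counting using (count; sum-map-const)
open Fractions using (frac≡weighted-sum)
import Data.Nat as ℕ
import Data.Nat.Properties as ℕ
open import Data.Nat.ListAction using (sum)
open import Data.List using (length)
open import Data.Unit using (⊤; tt)
open import Function using (_∘_)
open import Data.Product using (Σ; _×_; proj₁; proj₂)
open import Relation.Unary using (Decidable)
open import Relation.Nullary using (yes)
open import Relation.Binary.PropositionalEquality using (trans; sym)

proposition2p10 :
  (F : FiniteField) → IsPrimePower (FiniteField.order F) →
  (c : ℕ) → 1 ≤ c →
  (t : ℤ) → -1ℤ ≤ℤ t →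
  (r m : ℕ) (A : Mat F r m) →
  All (All (λ a → Coprime ∣ a ∣ (FiniteField.order F))) (Data.Vec.toList (Data.Vec.map Data.Vec.toList A)) →
  FullRank F A →
  (n : ℕ) → SLNonempty F A n →
  Admissible F A t →
  (D : ℕ) → DimL F A t D →
  (k : ℕ) → D ≤ k → k ≤ n →
  (R : List (Coloring F c k)) → IsColReps F k t R →
  (M : List (Aff F k n)) → IsMonReps F k n t M →
  (γ : Coloring F c n) (i : Fin c) →
  sDens F A t D n (Class F γ i) (class? F γ i)
    ≡ sumℚ (map (λ δ → sDens F A t D k (Class F δ i) (class? F δ i) * pt F t M δ γ) R)
proposition2p10 F _ c _ t _ r m A _ _ n _ admissible D dimL k D≤k k≤n R colReps M monReps γ i =
  frac≡weighted-sum a b bₖ (length M) N f y R (solutions-nonempty dimL D≤k) M-nonempty coloured total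
  where
  open DoubleCounting F t A admissible D
  open MonomorphismRepresentatives M monReps
  sₙ : Σ (Vec (Pt F n) m) λ s → IsSol F A s × DimIs F t s D
  sₙ = solution-exists dimL (ℕ.≤-trans D≤k k≤n)
  a b bₖ N : ℕ
  a = countSt F A t D n (Class F γ i) (class? F γ i)
  b = countSt F A t D n (λ _ → ⊤) (λ _ → yes tt)
  bₖ = countSt F A t D k (λ _ → ⊤) (λ _ → yes tt)
  N = through M (proj₁ sₙ)
  f y : Coloring F c k → ℕ
  f δ = colourCount δ i
  y δ = count (λ φ → iso? F t (γ ∘ apply F φ) δ) M
  pullbacks : ∀ {T : Pt F n → Set} (T? : Decidable T) → pullbackSum T? ≡ N ℕ.* countSt F A t D n T T?
  pullbacks = sum-countSt-pullbacks (proj₂ (proj₂ sₙ))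
  M-nonempty : 0 ℕ.< length M
  M-nonempty = representatives-nonempty k≤n (ℕ.≤-trans (dimL⇒≤ dimL) D≤k)
  coloured : sum (map (λ δ → f δ ℕ.* y δ) R) ≡ a ℕ.* N
  coloured = trans (sum-over-colourings R colReps M γ i) (trans (pullbacks (class? F γ i)) (ℕ.*-comm N a))
  total : length M ℕ.* bₖ ≡ b ℕ.* N
  total = trans (sym (sum-map-const bₖ M)) (trans (pullbacks (λ _ → yes tt)) (ℕ.*-comm N b))
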